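{- There exists a computable connected graph $G_\omega$ whose distance function is intrinsically approximable from above, and such that for every total function $f:\omega\to\omega$ approximable from above, there exists a computable graph $G_f$ isomorphic to $G_\omega$ whose distance function $d_f$ satisfies $d_f\le_{2\text{ -btt}} f$ and $f\le_{1\text{ -btt}} d_f$.
   Context: A graph is computable if its domain is $\omega$ or a finite initial segment of $\omega$ and its (symmetric, irreflexive) edge relation is computable. The distance function of a connected graph gives the length of the shortest path between nodes, regarded as a function on $\omega$ via a fixed computable pairing. A total $h$ is approximable from above if $h(x)=\lim_s g(x,s)$ for a total computable $g$ with $g(x,s+1)\le g(x,s)$. The distance function of $G$ is intrinsically approximable from above if for every computable graph $H\cong G$ the distance function on $H$ is approximable from above. For total $\alpha,\beta$, with $D_e$ the finite set of canonical index $e$: $\alpha\le_{k\text{ -btt}}\beta$ if there are total computable $p,q$ with $|D_{p(x)}|\le k$ and $\alpha(x)=q(x,\beta\restriction D_{p(x)})$ for all $x$. -}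

module Defs where

open import Data.Nat using (ℕ; zero; suc; _+_; _*_; _^_; _≤_; _<_; _/_; _%_)
open import Data.Fin using (Fin)
open import Data.Vec using (Vec; []; _∷_; lookup)
open import Data.Bool using (Bool; true; false)
open import Data.Maybe using (Maybe; nothing; just)
open import Data.Unit using (⊤)
open import Data.Product using (Σ; ∃; _×_; _,_)
open import Relation.Nullary using (¬_)
open import Relation.Binary.PropositionalEquality using (_≡_)

data PR : ℕ → Set where
  Zf : ∀ {n} → PR n
  Sf : PR 1
  Pf : ∀ {n} → Fin n → PR n
  Cf : ∀ {n m} → PR m → Vec (PR n) m → PR n
  Rf : ∀ {n} → PR n → PR (suc (suc n)) → PR (suc n)   -- primitive recursion (on 1st arg)
  Mf : ∀ {n} → PR (suc n) → PR n

mutual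
  data _[_]⇓_ : ∀ {n} → PR n → Vec ℕ n → ℕ → Set where
    evZ : ∀ {n} {xs : Vec ℕ n} → Zf [ xs ]⇓ 0
    evS : ∀ {x} → Sf [ x ∷ [] ]⇓ suc x
    evP : ∀ {n} {i : Fin n} {xs} → Pf i [ xs ]⇓ lookup xs i
    evC : ∀ {n m} {f : PR m} {gs : Vec (PR n) m} {xs ys z} →
          gs [ xs ]⇓* ys → f [ ys ]⇓ z → Cf f gs [ xs ]⇓ z
    evR0 : ∀ {n} {f : PR n} {g xs z} → f [ xs ]⇓ z → Rf f g [ 0 ∷ xs ]⇓ z
    evRS : ∀ {n} {f : PR n} {g xs k z w} →
           Rf f g [ k ∷ xs ]⇓ z → g [ k ∷ z ∷ xs ]⇓ w → Rf f g [ suc k ∷ xs ]⇓ w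
    evM : ∀ {n} {f : PR (suc n)} {xs k} →
          f [ k ∷ xs ]⇓ 0 →
          (∀ j → j < k → ∃ λ v → f [ j ∷ xs ]⇓ suc v) →
          Mf f [ xs ]⇓ k

  data _[_]⇓*_ : ∀ {n m} → Vec (PR n) m → Vec ℕ n → Vec ℕ m → Set where
    ev[] : ∀ {n} {xs : Vec ℕ n} → [] [ xs ]⇓* []
    ev∷  : ∀ {n m} {g : PR n} {gs : Vec (PR n) m} {xs y ys} →
           g [ xs ]⇓ y → gs [ xs ]⇓* ys → (g ∷ gs) [ xs ]⇓* (y ∷ ys)

Computable₁ : (ℕ → ℕ) → Set
Computable₁ f = Σ (PR 1) λ c → ∀ x → c [ x ∷ [] ]⇓ f x

Computable₂ : (ℕ → ℕ → ℕ) → Set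
Computable₂ f = Σ (PR 2) λ c → ∀ x y → c [ x ∷ y ∷ [] ]⇓ f x y

Σ< : ℕ → (ℕ → ℕ) → ℕ
Σ< zero    f = 0
Σ< (suc n) f = Σ< n f + f n

tri : ℕ → ℕ
tri zero    = 0
tri (suc n) = tri n + suc n

⟪_,_⟫ : ℕ → ℕ → ℕ
⟪ x , y ⟫ = tri (x + y) + y

bit : ℕ → ℕ → ℕ
bit e zero    = e % 2
bit e (suc i) = bit (e / 2) i

-- canonical finite sets: i ∈ D_e iff bit e i ≡ 1  (all such i are < e)
-- |D_e|
card : ℕ → ℕ
card e = Σ< e (bit e)

-- canonical index of the finite function β ↾ D_e, i.e. of the finite
-- set of pairs { ⟪ i , β i ⟫ : i ∈ D_e }
restrCode : (ℕ → ℕ) → ℕ → ℕ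
restrCode β e = Σ< e (λ i → bit e i * 2 ^ ⟪ i , β i ⟫)

_≤[_]btt_ : (ℕ → ℕ) → ℕ → (ℕ → ℕ) → Set
α ≤[ k ]btt β = Σ (ℕ → ℕ) λ p → Σ (ℕ → ℕ → ℕ) λ q →
  Computable₁ p × Computable₂ q ×
  (∀ x → card (p x) ≤ k × α x ≡ q x (restrCode β (p x)))

ApproxAbove : (ℕ → ℕ) → Set
ApproxAbove h = Σ (ℕ → ℕ → ℕ) λ g → Computable₂ g ×
  (∀ x s → g x (suc s) ≤ g x s) ×
  (∀ x → ∃ λ s₀ → ∀ s → s₀ ≤ s → g x s ≡ h x)

InDom : Maybe ℕ → ℕ → Set
InDom nothing  x = ⊤
InDom (just n) x = x < n

χ : Bool → ℕ
χ true  = 1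
χ false = 0

record CGraph : Set where
  field
    size      : Maybe ℕ
    edge      : ℕ → ℕ → Bool
    edge-comp : Computable₂ (λ x y → χ (edge x y))
    symm      : ∀ x y → edge x y ≡ edge y x
    irrefl    : ∀ x → edge x x ≡ false
    edge-dom  : ∀ x y → edge x y ≡ true → InDom size x × InDom size y
open CGraph public

Dom : CGraph → ℕ → Set
Dom G = InDom (size G)

data Walk (G : CGraph) : ℕ → ℕ → ℕ → Set where
  here : ∀ {x} → Walk G x x 0
  step : ∀ {x z y n} → edge G x z ≡ true → Walk G z y n → Walk G x y (suc n)

Connected : CGraph → Set
Connected G = ∀ x y → Dom G x → Dom G y → ∃ λ n → Walk G x y n

IsDist : CGraph → ℕ → ℕ → ℕ → Set
IsDist G x y d = Walk G x y d × (∀ m → Walk G x y m → d ≤ m)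

-- h is the distance function of G (as a function on ω via ⟪_,_⟫;
-- convention: value 0 on codes of pairs outside the domain)
IsDistFn : CGraph → (ℕ → ℕ) → Set
IsDistFn G h = ∀ x y →
  ((Dom G x × Dom G y) → IsDist G x y (h ⟪ x , y ⟫)) ×
  (¬ (Dom G x × Dom G y) → h ⟪ x , y ⟫ ≡ 0)

-- graph isomorphism (not required to be computable)
_≅_ : CGraph → CGraph → Set
G ≅ H = Σ (ℕ → ℕ) λ φ → Σ (ℕ → ℕ) λ ψ →
  (∀ x → Dom G x → Dom H (φ x)) ×
  (∀ y → Dom H y → Dom G (ψ y)) ×
  (∀ x → Dom G x → ψ (φ x) ≡ x) ×
  (∀ y → Dom H y → φ (ψ y) ≡ y) ×
  (∀ x y → Dom G x → Dom G y → edge G x y ≡ edge H (φ x) (φ y))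

IntrinsicallyApproxAbove : CGraph → Set
IntrinsicallyApproxAbove G = ∀ (H : CGraph) → G ≅ H →
  ∀ (h : ℕ → ℕ) → IsDistFn H h → ApproxAbove h

-- For a computable approximation A a s ↘ K a, the gadget graph G(A) has a hub and, for every a, a ray
-- hub = r₀, r₁, r₂, …, an apex, and for all s, m a link adjacent to the apex and to r (A a s + m). The links reach
-- exactly the heights ≥ K a, so the apex lies at distance K a + 2 from the hub, and all distances are given by an
-- explicit formula in the limits K of the (at most two) gadgets involved: the formula vanishes on the diagonal and
-- changes by at most 1 along an edge, so it bounds every walk from below, and explicit walks attain it.
-- G_ω uses every limit k for infinitely many gadgets; G_f moreover has a gadget of limit f x for every x. A gadget
-- is determined up to isomorphism by its limit, so a Hilbert-hotel relabelling of the gadgets gives G_ω ≅ G_f.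
-- Now f x + 2 is the distance from the hub to the apex of gadget ⟪ x , 0 ⟫, while a distance in G_f only needs f
-- at the two gadgets involved. Finally, a computable copy of G_ω is infinite and connected, and there the minimum
-- length of the walks enumerated so far approximates the distance from above, starting from a first walk found by
-- unbounded search.

module Submission where

open import Defs
open import Data.Bool using (Bool; true; false)
open import Data.Empty using (⊥; ⊥-elim)
open import Data.Fin using (Fin; zero; suc; #_; toℕ; fromℕ<)
open import Data.Fin.Properties using (pigeonhole; toℕ-fromℕ<)
open import Data.Maybe using (nothing; just)
open import Data.Nat using (ℕ; zero; suc; pred; _+_; _*_; _∸_; _^_; _/_; _%_; _⊓_; ∣_-_∣; _≤_; _<_; z≤n; s≤s; _≟_; _≤?_; _<ᵇ_)
open import Data.Nat.DivMod
open import Data.Nat.Properties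
open import Algebra.Properties.CommutativeSemigroup +-commutativeSemigroup using (interchange)
open import Data.Product using (Σ; ∃; _×_; _,_; proj₁; proj₂)
open import Data.Sum using (_⊎_; inj₁; inj₂)
open import Data.Unit using (tt)
open import Data.Vec using (Vec; []; _∷_; lookup; tabulate)
open import Data.Vec.Properties using (tabulate∘lookup)
open import Function using (_∘_)
open import Relation.Binary.Definitions using (tri<; tri≈; tri>)
open import Relation.Binary.PropositionalEquality
open import Relation.Nullary using (¬_; yes; no)

record ComputableFn (n : ℕ) : Set where
  constructor computableFn
  field
    fn      : Vec ℕ n → ℕ
    program : PR n
    runs    : ∀ xs → program [ xs ]⇓ fn xs
open ComputableFn public

fromComputable₂ : ∀ {f} → Computable₂ f → ComputableFn 2
fromComputable₂ {f} (c , runs) = computableFn (λ { (x ∷ y ∷ []) → f x y }) c (λ { (x ∷ y ∷ []) → runs x y })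

primrec : ℕ → (ℕ → ℕ → ℕ) → ℕ → ℕ
primrec z s zero    = z
primrec z s (suc k) = s k (primrec z s k)

data Exp (n : ℕ) : Set where
  var : Fin n → Exp n
  zer : Exp n
  sc  : Exp n → Exp n
  app : ∀ {m} → ComputableFn m → Vec (Exp n) m → Exp n
  -- rec k z s  denotes  primrec z s k,  with s seeing the counter and the previous value first
  rec : Exp n → Exp n → Exp (suc (suc n)) → Exp n

mutual
  ⟦_⟧ : ∀ {n} → Exp n → Vec ℕ n → ℕ
  ⟦ var i ⟧     xs = lookup xs i
  ⟦ zer ⟧       xs = 0
  ⟦ sc e ⟧      xs = suc (⟦ e ⟧ xs)
  ⟦ app f es ⟧  xs = fn f (⟦ es ⟧* xs)
  ⟦ rec k z s ⟧ xs = primrec (⟦ z ⟧ xs) (λ i r → ⟦ s ⟧ (i ∷ r ∷ xs)) (⟦ k ⟧ xs)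

  ⟦_⟧* : ∀ {n m} → Vec (Exp n) m → Vec ℕ n → Vec ℕ m
  ⟦ [] ⟧*     xs = []
  ⟦ e ∷ es ⟧* xs = ⟦ e ⟧ xs ∷ ⟦ es ⟧* xs

mutual
  compile : ∀ {n} → Exp n → PR n
  compile (var i)     = Pf i
  compile zer         = Zf
  compile (sc e)      = Cf Sf (compile e ∷ [])
  compile (app f es)  = Cf (program f) (compile* es)
  compile (rec k z s) = Cf (Rf (compile z) (compile s)) (compile k ∷ tabulate Pf)

  compile* : ∀ {n m} → Vec (Exp n) m → Vec (PR n) m
  compile* []       = []
  compile* (e ∷ es) = compile e ∷ compile* es

projections-run : ∀ {n} (xs : Vec ℕ n) → tabulate Pf [ xs ]⇓* xs
projections-run xs = subst (tabulate Pf [ xs ]⇓*_) (tabulate∘lookup xs) (go (λ i → i))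
  where
  go : ∀ {m} (f : Fin m → Fin _) → tabulate (Pf ∘ f) [ xs ]⇓* tabulate (lookup xs ∘ f)
  go {zero}  f = ev[]
  go {suc m} f = ev∷ evP (go (f ∘ suc))

primrec-runs : ∀ {n} {f : PR n} {g : PR (suc (suc n))} {xs z s} →
               f [ xs ]⇓ z → (∀ k r → g [ k ∷ r ∷ xs ]⇓ s k r) →
               ∀ k → Rf f g [ k ∷ xs ]⇓ primrec z s k
primrec-runs fz gs zero    = evR0 fz
primrec-runs fz gs (suc k) = evRS (primrec-runs fz gs k) (gs k _)

mutual
  compile-correct : ∀ {n} (e : Exp n) xs → compile e [ xs ]⇓ ⟦ e ⟧ xs
  compile-correct (var i)     xs = evP
  compile-correct zer         xs = evZ
  compile-correct (sc e)      xs = evC (ev∷ (compile-correct e xs) ev[]) evS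
  compile-correct (app f es)  xs = evC (compile*-correct es xs) (runs f _)
  compile-correct (rec k z s) xs =
    evC (ev∷ (compile-correct k xs) (projections-run xs))
        (primrec-runs (compile-correct z xs) (λ i r → compile-correct s (i ∷ r ∷ xs)) (⟦ k ⟧ xs))

  compile*-correct : ∀ {n m} (es : Vec (Exp n) m) xs → compile* es [ xs ]⇓* ⟦ es ⟧* xs
  compile*-correct []       xs = ev[]
  compile*-correct (e ∷ es) xs = ev∷ (compile-correct e xs) (compile*-correct es xs)

fromExp : ∀ {n} (e : Exp n) (f : Vec ℕ n → ℕ) → (∀ xs → ⟦ e ⟧ xs ≡ f xs) → ComputableFn n
fromExp e f eq = computableFn f (compile e) (λ xs → subst (compile e [ xs ]⇓_) (eq xs) (compile-correct e xs))

computable₁ : (f : ℕ → ℕ) (e : Exp 1) → (∀ x → ⟦ e ⟧ (x ∷ []) ≡ f x) → Computable₁ f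
computable₁ f e eq = compile e , λ x → subst (compile e [ x ∷ [] ]⇓_) (eq x) (compile-correct e (x ∷ []))

computable₂ : (f : ℕ → ℕ → ℕ) (e : Exp 2) → (∀ x y → ⟦ e ⟧ (x ∷ y ∷ []) ≡ f x y) → Computable₂ f
computable₂ f e eq = compile e , λ x y → subst (compile e [ x ∷ y ∷ [] ]⇓_) (eq x y) (compile-correct e (x ∷ y ∷ []))

v₀ : ∀ {n} → Exp (suc n)
v₀ = var zero
v₁ : ∀ {n} → Exp (suc (suc n))
v₁ = var (suc zero)
v₂ : ∀ {n} → Exp (suc (suc (suc n)))
v₂ = var (suc (suc zero))
v₃ : ∀ {n} → Exp (suc (suc (suc (suc n))))
v₃ = var (suc (suc (suc zero)))
v₄ : ∀ {n} → Exp (suc (suc (suc (suc (suc n)))))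
v₄ = var (suc (suc (suc (suc zero))))

app₁ : ∀ {n} → ComputableFn 1 → Exp n → Exp n
app₁ f a = app f (a ∷ [])
app₂ : ∀ {n} → ComputableFn 2 → Exp n → Exp n → Exp n
app₂ f a b = app f (a ∷ b ∷ [])

lit : ∀ {n} → ℕ → Exp n
lit zero    = zer
lit (suc k) = sc (lit k)

ifz : ℕ → ℕ → ℕ → ℕ
ifz zero    a b = a
ifz (suc _) a b = b

ifzᶜ : ComputableFn 3
ifzᶜ = fromExp (rec v₀ v₁ v₄) (λ { (c ∷ a ∷ b ∷ []) → ifz c a b }) λ where
  (zero  ∷ a ∷ b ∷ []) → refl
  (suc c ∷ a ∷ b ∷ []) → refl

predᶜ : ComputableFn 1
predᶜ = fromExp (rec v₀ zer v₀) (λ { (x ∷ []) → pred x }) λ where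
  (zero  ∷ []) → refl
  (suc x ∷ []) → refl

addᶜ : ComputableFn 2
addᶜ = fromExp (rec v₀ v₁ (sc v₁)) (λ { (x ∷ y ∷ []) → x + y }) (λ { (x ∷ y ∷ []) → spec x y })
  where
  spec : ∀ x y → primrec y (λ _ r → suc r) x ≡ x + y
  spec zero    y = refl
  spec (suc x) y = cong suc (spec x y)

mulᶜ : ComputableFn 2
mulᶜ = fromExp (rec v₀ zer (app₂ addᶜ v₃ v₁)) (λ { (x ∷ y ∷ []) → x * y }) (λ { (x ∷ y ∷ []) → spec x y })
  where
  spec : ∀ x y → primrec 0 (λ _ r → y + r) x ≡ x * y
  spec zero    y = refl
  spec (suc x) y = cong (y +_) (spec x y)

monusᶜ : ComputableFn 2
monusᶜ = fromExp (rec v₁ v₀ (app₁ predᶜ v₁)) (λ { (x ∷ y ∷ []) → x ∸ y }) (λ { (x ∷ y ∷ []) → spec x y })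
  where
  spec : ∀ x y → primrec x (λ _ r → pred r) y ≡ x ∸ y
  spec x zero    = refl
  spec x (suc y) = trans (cong pred (spec x y)) (pred[m∸n]≡m∸[1+n] x y)

infixl 6 _⊕_ _⊖_
infixl 7 _⊗_

_⊕_ _⊗_ _⊖_ : ∀ {n} → Exp n → Exp n → Exp n
a ⊕ b = app₂ addᶜ a b
a ⊗ b = app₂ mulᶜ a b
a ⊖ b = app₂ monusᶜ a b

IFZ : ∀ {n} → Exp n → Exp n → Exp n → Exp n
IFZ c a b = app ifzᶜ (c ∷ a ∷ b ∷ [])

-- Kronecker delta and the indicator of ≤, as numbers so that they can be computed and multiplied
δ : ℕ → ℕ → ℕ
δ zero    zero    = 1
δ zero    (suc b) = 0
δ (suc a) zero    = 0
δ (suc a) (suc b) = δ a b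

leq : ℕ → ℕ → ℕ
leq zero    b       = 1
leq (suc a) zero    = 0
leq (suc a) (suc b) = leq a b

δ-refl : ∀ a → δ a a ≡ 1
δ-refl zero    = refl
δ-refl (suc a) = δ-refl a

δ≡1⇒≡ : ∀ a b → δ a b ≡ 1 → a ≡ b
δ≡1⇒≡ zero    zero    _ = refl
δ≡1⇒≡ (suc a) (suc b) e = cong suc (δ≡1⇒≡ a b e)

≢⇒δ≡0 : ∀ a b → ¬ a ≡ b → δ a b ≡ 0
≢⇒δ≡0 zero    zero    ne = ⊥-elim (ne refl)
≢⇒δ≡0 zero    (suc b) ne = refl
≢⇒δ≡0 (suc a) zero    ne = refl
≢⇒δ≡0 (suc a) (suc b) ne = ≢⇒δ≡0 a b (ne ∘ cong suc)

δ≡0⊎δ≡1 : ∀ a b → δ a b ≡ 0 ⊎ δ a b ≡ 1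
δ≡0⊎δ≡1 zero    zero    = inj₂ refl
δ≡0⊎δ≡1 zero    (suc b) = inj₁ refl
δ≡0⊎δ≡1 (suc a) zero    = inj₁ refl
δ≡0⊎δ≡1 (suc a) (suc b) = δ≡0⊎δ≡1 a b

δ≢0⇒≡ : ∀ a b → ¬ δ a b ≡ 0 → a ≡ b
δ≢0⇒≡ a b ne with δ≡0⊎δ≡1 a b
... | inj₁ e = ⊥-elim (ne e)
... | inj₂ e = δ≡1⇒≡ a b e

≤⇒leq≡1 : ∀ {a b} → a ≤ b → leq a b ≡ 1
≤⇒leq≡1 {zero}          _       = refl
≤⇒leq≡1 {suc a} {suc b} (s≤s p) = ≤⇒leq≡1 p

>⇒leq≡0 : ∀ {a b} → b < a → leq a b ≡ 0
>⇒leq≡0 {suc a} {zero}  _       = refl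
>⇒leq≡0 {suc a} {suc b} (s≤s p) = >⇒leq≡0 p

leq≢0⇒≤ : ∀ a b → ¬ leq a b ≡ 0 → a ≤ b
leq≢0⇒≤ zero    b       _  = z≤n
leq≢0⇒≤ (suc a) zero    ne = ⊥-elim (ne refl)
leq≢0⇒≤ (suc a) (suc b) ne = s≤s (leq≢0⇒≤ a b ne)

∣-∣-as-monus : ∀ a b → (a ∸ b) + (b ∸ a) ≡ ∣ a - b ∣
∣-∣-as-monus zero    zero    = refl
∣-∣-as-monus zero    (suc b) = refl
∣-∣-as-monus (suc a) zero    = +-identityʳ (suc a)
∣-∣-as-monus (suc a) (suc b) = ∣-∣-as-monus a b

absᶜ : ComputableFn 2
absᶜ = fromExp ((v₀ ⊖ v₁) ⊕ (v₁ ⊖ v₀)) (λ { (a ∷ b ∷ []) → ∣ a - b ∣ }) (λ { (a ∷ b ∷ []) → ∣-∣-as-monus a b })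

δᶜ : ComputableFn 2
δᶜ = fromExp (IFZ (app₂ absᶜ v₀ v₁) (lit 1) zer) (λ { (a ∷ b ∷ []) → δ a b }) (λ { (a ∷ b ∷ []) → spec a b })
  where
  spec : ∀ a b → ifz ∣ a - b ∣ 1 0 ≡ δ a b
  spec zero    zero    = refl
  spec zero    (suc b) = refl
  spec (suc a) zero    = refl
  spec (suc a) (suc b) = spec a b

leqᶜ : ComputableFn 2
leqᶜ = fromExp (IFZ (v₀ ⊖ v₁) (lit 1) zer) (λ { (a ∷ b ∷ []) → leq a b }) (λ { (a ∷ b ∷ []) → spec a b })
  where
  spec : ∀ a b → ifz (a ∸ b) 1 0 ≡ leq a b
  spec zero    zero    = refl
  spec zero    (suc b) = refl
  spec (suc a) zero    = refl
  spec (suc a) (suc b) = spec a b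

minᶜ : ComputableFn 2
minᶜ = fromExp (v₀ ⊖ (v₀ ⊖ v₁)) (λ { (a ∷ b ∷ []) → a ⊓ b }) (λ { (a ∷ b ∷ []) → spec a b })
  where
  spec : ∀ a b → a ∸ (a ∸ b) ≡ a ⊓ b
  spec zero    b       = 0∸n≡0 (0 ∸ b)
  spec (suc a) zero    = n∸n≡0 a
  spec (suc a) (suc b) = trans (+-∸-assoc 1 (m∸n≤m a b)) (cong suc (spec a b))

infix 4 _==_
_==_ : ∀ {n} → Exp n → Exp n → Exp n
a == b = app₂ δᶜ a b

-- the least v < B with p v ≢ 0, and B if there is none
search : (ℕ → ℕ) → ℕ → ℕ
search p = primrec 0 (λ k r → ifz (p r) (suc k) r)

module _ (p : ℕ → ℕ) where

  search-hit : ∀ B → p (search p B) ≡ 0 → search p B ≡ B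
  search-hit zero    _ = refl
  search-hit (suc B) h with p (search p B) in eq
  ... | zero  = refl
  ... | suc _ = ⊥-elim (1+n≢0 (trans (sym eq) h))

  search-minimal : ∀ B u → u < search p B → p u ≡ 0
  search-minimal (suc B) u u< with p (search p B) in eq
  ... | suc _ = search-minimal B u u<
  ... | zero with m≤n⇒m<n∨m≡n (≤-pred u<)
  ...   | inj₁ u<B  = search-minimal B u (subst (u <_) (sym (search-hit B eq)) u<B)
  ...   | inj₂ refl = trans (cong p (sym (search-hit B eq))) eq

  search-witness : ∀ B → ¬ p B ≡ 0 → ¬ p (search p B) ≡ 0
  search-witness B pB≢0 h = pB≢0 (subst (λ v → p v ≡ 0) (search-hit B h) h)

  search-unique : ∀ {v} B → (∀ u → u < v → p u ≡ 0) → ¬ p v ≡ 0 → v ≤ B → search p B ≡ v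
  search-unique {v} B below pv≢0 v≤B with <-cmp (search p B) v
  ... | tri< lt _ _ = ⊥-elim (<-irrefl refl (<-≤-trans lt (subst (v ≤_) (sym (search-hit B (below _ lt))) v≤B)))
  ... | tri≈ _ eq _ = eq
  ... | tri> _ _ gt = ⊥-elim (pv≢0 (search-minimal B v gt))

triᶜ : ComputableFn 1
triᶜ = fromExp (rec v₀ zer (v₁ ⊕ sc v₀)) (λ { (x ∷ []) → tri x }) (λ { (x ∷ []) → spec x })
  where
  spec : ∀ x → primrec 0 (λ k r → r + suc k) x ≡ tri x
  spec zero    = refl
  spec (suc x) = cong (_+ suc x) (spec x)

pairᶜ : ComputableFn 2
pairᶜ = fromExp (app₁ triᶜ (v₀ ⊕ v₁) ⊕ v₁) (λ { (x ∷ y ∷ []) → ⟪ x , y ⟫ }) (λ { (x ∷ y ∷ []) → refl })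

tri-mono-≤ : ∀ {a b} → a ≤ b → tri a ≤ tri b
tri-mono-≤ {zero}          _       = z≤n
tri-mono-≤ {suc a} {suc b} (s≤s p) = +-mono-≤ (tri-mono-≤ p) (s≤s p)

n≤tri[n] : ∀ n → n ≤ tri n
n≤tri[n] zero    = z≤n
n≤tri[n] (suc n) = m≤n+m (suc n) (tri n)

Σ<-cong : ∀ n {f g} → (∀ s → s < n → f s ≡ g s) → Σ< n f ≡ Σ< n g
Σ<-cong zero    h = refl
Σ<-cong (suc n) h = cong₂ _+_ (Σ<-cong n (λ s p → h s (m≤n⇒m≤1+n p))) (h n ≤-refl)

OnDiagonal : ℕ → ℕ → Set
OnDiagonal z m = tri m ≤ z × z < tri (suc m)

onDiagonal : ∀ z → ∃ (OnDiagonal z)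
onDiagonal zero = 0 , z≤n , s≤s z≤n
onDiagonal (suc z) with onDiagonal z
... | m , p , q with m≤n⇒m<n∨m≡n q
...   | inj₁ r = m , m≤n⇒m≤1+n p , r
...   | inj₂ r = suc m , ≤-reflexive (sym r) , subst (_< tri (suc (suc m))) (sym r) (m<m+n (tri (suc m)) (s≤s z≤n))

-- the number of diagonals lying entirely below z, i.e. the index of the diagonal of z
diagonal : ℕ → ℕ
diagonal z = Σ< z (λ s → leq (tri (suc s)) z)

diagonalᶜ : ComputableFn 1
diagonalᶜ = fromExp (rec v₀ zer (v₁ ⊕ app₂ leqᶜ (app₁ triᶜ (sc v₀)) v₂)) (λ { (z ∷ []) → diagonal z })
                    (λ { (z ∷ []) → spec z z })
  where
  spec : ∀ z n → primrec 0 (λ k r → r + leq (tri (suc k)) z) n ≡ Σ< n (λ s → leq (tri (suc s)) z)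
  spec z zero    = refl
  spec z (suc n) = cong (_+ leq (tri (suc n)) z) (spec z n)

diagonal-unique : ∀ {z m} → OnDiagonal z m → diagonal z ≡ m
diagonal-unique {z} {m} (p , q) = trans (Σ<-cong z indicator) (count m z (≤-trans (n≤tri[n] m) p))
  where
  indicator : ∀ s → s < z → leq (tri (suc s)) z ≡ leq (suc s) m
  indicator s _ with suc s ≤? m
  ... | yes r = trans (≤⇒leq≡1 (≤-trans (tri-mono-≤ r) p)) (sym (≤⇒leq≡1 r))
  ... | no r  = trans (>⇒leq≡0 (<-≤-trans q (tri-mono-≤ (≰⇒> r)))) (sym (>⇒leq≡0 (≰⇒> r)))
  ones : ∀ n → Σ< n (λ s → leq (suc s) n) ≡ n
  ones n = trans (Σ<-cong n (λ s p → ≤⇒leq≡1 p)) (all-one n)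
    where
    all-one : ∀ n → Σ< n (λ _ → 1) ≡ n
    all-one zero    = refl
    all-one (suc n) = trans (cong (_+ 1) (all-one n)) (+-comm n 1)
  count : ∀ m n → m ≤ n → Σ< n (λ s → leq (suc s) m) ≡ m
  count m zero    p = sym (n≤0⇒n≡0 p)
  count m (suc n) p with m≤n⇒m<n∨m≡n p
  ... | inj₁ (s≤s q) = trans (cong₂ _+_ (count m n q) (>⇒leq≡0 (s≤s q))) (+-identityʳ m)
  ... | inj₂ refl    = ones (suc n)

diagonal-onDiagonal : ∀ z → OnDiagonal z (diagonal z)
diagonal-onDiagonal z with onDiagonal z
... | m , on = subst (OnDiagonal z) (sym (diagonal-unique on)) on

diagonal-⟪⟫ : ∀ x y → diagonal ⟪ x , y ⟫ ≡ x + y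
diagonal-⟪⟫ x y = diagonal-unique (m≤m+n (tri (x + y)) y , +-monoʳ-< (tri (x + y)) (s≤s (m≤n+m y x)))

-- opaque, so that rewriting with the lemmas below does not expose the arithmetic
opaque
  π₁ π₂ : ℕ → ℕ
  π₂ z = z ∸ tri (diagonal z)
  π₁ z = diagonal z ∸ π₂ z

opaque
  unfolding π₁

  π₂-definition : ∀ z → z ∸ tri (diagonal z) ≡ π₂ z
  π₂-definition z = refl

  π₁-definition : ∀ z → diagonal z ∸ π₂ z ≡ π₁ z
  π₁-definition z = refl

  π₁-0 : π₁ 0 ≡ 0
  π₁-0 = refl

  π₂-0 : π₂ 0 ≡ 0
  π₂-0 = refl

  π₂-⟪⟫ : ∀ x y → π₂ ⟪ x , y ⟫ ≡ y
  π₂-⟪⟫ x y rewrite diagonal-⟪⟫ x y = m+n∸m≡n (tri (x + y)) y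

  π₁-⟪⟫ : ∀ x y → π₁ ⟪ x , y ⟫ ≡ x
  π₁-⟪⟫ x y rewrite π₂-⟪⟫ x y | diagonal-⟪⟫ x y = m+n∸n≡m x y

  ⟪π₁,π₂⟫ : ∀ z → ⟪ π₁ z , π₂ z ⟫ ≡ z
  ⟪π₁,π₂⟫ z with diagonal-onDiagonal z
  ... | p , q = trans (cong (λ t → tri t + π₂ z) π₁+π₂) (m+[n∸m]≡n p)
    where
    π₁+π₂ : π₁ z + π₂ z ≡ diagonal z
    π₁+π₂ = m∸n+n≡m (≤-pred (m<n+o⇒m∸n<o z (tri (diagonal z)) q))

π₂ᶜ : ComputableFn 1
π₂ᶜ = fromExp (v₀ ⊖ app₁ triᶜ (app₁ diagonalᶜ v₀)) (λ { (z ∷ []) → π₂ z }) (λ { (z ∷ []) → π₂-definition z })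

π₁ᶜ : ComputableFn 1
π₁ᶜ = fromExp (app₁ diagonalᶜ v₀ ⊖ app₁ π₂ᶜ v₀) (λ { (z ∷ []) → π₁ z }) (λ { (z ∷ []) → π₁-definition z })

⟪⟫-injective₁ : ∀ {a b c d} → ⟪ a , b ⟫ ≡ ⟪ c , d ⟫ → a ≡ c
⟪⟫-injective₁ {a} {b} {c} {d} e = trans (sym (π₁-⟪⟫ a b)) (trans (cong π₁ e) (π₁-⟪⟫ c d))

⟪⟫-injective₂ : ∀ {a b c d} → ⟪ a , b ⟫ ≡ ⟪ c , d ⟫ → b ≡ d
⟪⟫-injective₂ {a} {b} {c} {d} e = trans (sym (π₂-⟪⟫ a b)) (trans (cong π₂ e) (π₂-⟪⟫ c d))

y≤⟪x,y⟫ : ∀ x y → y ≤ ⟪ x , y ⟫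
y≤⟪x,y⟫ x y = m≤n+m y (tri (x + y))

parity half : ℕ → ℕ
parity = primrec 0 (λ _ r → 1 ∸ r)
half   = primrec 0 (λ k r → r + parity k)

parityᶜ : ComputableFn 1
parityᶜ = fromExp (rec v₀ zer (lit 1 ⊖ v₁)) (λ { (e ∷ []) → parity e }) (λ { (e ∷ []) → refl })

halfᶜ : ComputableFn 1
halfᶜ = fromExp (rec v₀ zer (v₁ ⊕ app₁ parityᶜ v₀)) (λ { (e ∷ []) → half e }) (λ { (e ∷ []) → refl })

parity≤1 : ∀ e → parity e ≤ 1
parity≤1 zero    = z≤n
parity≤1 (suc e) = m∸n≤m 1 (parity e)

parity≡%2 : ∀ e → parity e ≡ e % 2
parity≡%2 zero          = refl
parity≡%2 (suc zero)    = refl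
parity≡%2 (suc (suc e)) =
  trans (m∸[m∸n]≡n (parity≤1 e)) (trans (parity≡%2 e) (trans (sym ([m+n]%n≡m%n e 2)) (cong (_% 2) (+-comm e 2))))

half≡/2 : ∀ e → half e ≡ e / 2
half≡/2 zero          = refl
half≡/2 (suc zero)    = refl
half≡/2 (suc (suc e)) = trans (+-assoc (half e) (parity e) (1 ∸ parity e))
  (trans (cong₂ _+_ (half≡/2 e) (m+[n∸m]≡n (parity≤1 e)))
  (trans (+-comm (e / 2) 1) (sym (m/n≡1+[m∸n]/n {suc (suc e)} {2} (s≤s (s≤s z≤n))))))

bitᶜ : ComputableFn 2
bitᶜ = fromExp (app₁ parityᶜ (rec v₁ v₀ (app₁ halfᶜ v₁))) (λ { (e ∷ i ∷ []) → bit e i }) (λ { (e ∷ i ∷ []) → spec e i })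
  where
  halve : ℕ → ℕ → ℕ
  halve e = primrec e (λ _ r → half r)
  halve-suc : ∀ e i → halve (half e) i ≡ halve e (suc i)
  halve-suc e zero    = refl
  halve-suc e (suc i) = cong half (halve-suc e i)
  spec : ∀ e i → parity (halve e i) ≡ bit e i
  spec e zero    = parity≡%2 e
  spec e (suc i) = trans (cong parity (sym (halve-suc e i))) (trans (cong (λ t → parity (halve t i)) (half≡/2 e)) (spec (e / 2) i))

powᶜ : ComputableFn 1
powᶜ = fromExp (rec v₀ (lit 1) (lit 2 ⊗ v₁)) (λ { (n ∷ []) → 2 ^ n }) (λ { (n ∷ []) → spec n })
  where
  spec : ∀ n → primrec 1 (λ _ r → 2 * r) n ≡ 2 ^ n
  spec zero    = refl
  spec (suc n) = cong (2 *_) (spec n)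

bit-0 : ∀ i → bit 0 i ≡ 0
bit-0 zero    = refl
bit-0 (suc i) = bit-0 i

bit-2* : ∀ x i → bit (2 * x) (suc i) ≡ bit x i
bit-2* x i = cong (λ t → bit t i) (trans (cong (_/ 2) (*-comm 2 x)) (m*n/n≡m x 2))

bit-1+2* : ∀ x i → bit (1 + 2 * x) (suc i) ≡ bit x i
bit-1+2* x i = cong (λ t → bit t i) (trans (cong (λ t → (1 + t) / 2) (*-comm 2 x))
  (trans (+-distrib-/ 1 (x * 2) (subst (λ t → 1 + t < 2) (sym (m*n%n≡0 x 2)) (s≤s (s≤s z≤n)))) (m*n/n≡m x 2)))

2*x%2≡0 : ∀ x → (2 * x) % 2 ≡ 0
2*x%2≡0 x = trans (cong (_% 2) (*-comm 2 x)) (m*n%n≡0 x 2)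

[1+2*x]%2≡1 : ∀ x → (1 + 2 * x) % 2 ≡ 1
[1+2*x]%2≡1 x = trans (cong (λ t → (1 + t) % 2) (*-comm 2 x)) ([m+kn]%n≡m%n 1 x 2)

bit-2^ : ∀ p i → bit (2 ^ p) i ≡ δ i p
bit-2^ zero    zero    = refl
bit-2^ zero    (suc i) = trans (bit-1+2* 0 i) (bit-0 i)
bit-2^ (suc p) zero    = 2*x%2≡0 (2 ^ p)
bit-2^ (suc p) (suc i) = trans (bit-2* (2 ^ p) i) (bit-2^ p i)

bit-2^+2^ : ∀ p q → ¬ p ≡ q → ∀ i → bit (2 ^ p + 2 ^ q) i ≡ δ i p + δ i q
bit-2^+2^ zero    zero    ne i       = ⊥-elim (ne refl)
bit-2^+2^ zero    (suc q) ne zero    = [1+2*x]%2≡1 (2 ^ q)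
bit-2^+2^ zero    (suc q) ne (suc i) = trans (bit-1+2* (2 ^ q) i) (bit-2^ q i)
bit-2^+2^ (suc p) zero    ne zero    = trans (cong (_% 2) (+-comm (2 ^ suc p) 1)) ([1+2*x]%2≡1 (2 ^ p))
bit-2^+2^ (suc p) zero    ne (suc i) = trans (cong (λ t → bit t (suc i)) (+-comm (2 ^ suc p) 1))
  (trans (bit-1+2* (2 ^ p) i) (trans (bit-2^ p i) (sym (+-identityʳ (δ i p)))))
bit-2^+2^ (suc p) (suc q) ne zero    = trans (cong (_% 2) (sym (*-distribˡ-+ 2 (2 ^ p) (2 ^ q)))) (2*x%2≡0 (2 ^ p + 2 ^ q))
bit-2^+2^ (suc p) (suc q) ne (suc i) = trans (cong (λ t → bit t (suc i)) (sym (*-distribˡ-+ 2 (2 ^ p) (2 ^ q))))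
  (trans (bit-2* (2 ^ p + 2 ^ q) i) (bit-2^+2^ p q (λ e → ne (cong suc e)) i))

n<2^n : ∀ n → n < 2 ^ n
n<2^n zero    = s≤s z≤n
n<2^n (suc n) = subst (_≤ 2 ^ suc n) (+-comm (suc n) 1)
  (+-mono-≤ (n<2^n n) (≤-trans (s≤s z≤n) (subst (suc n ≤_) (sym (+-identityʳ (2 ^ n))) (n<2^n n))))

Σ<-δ : ∀ n p (F : ℕ → ℕ) → p < n → Σ< n (λ i → δ i p * F i) ≡ F p
Σ<-δ (suc n) p F p<1+n with m≤n⇒m<n∨m≡n p<1+n
... | inj₁ (s≤s p<n) =
  trans (cong₂ _+_ (Σ<-δ n p F p<n) (cong (_* F n) (≢⇒δ≡0 n p (λ e → <-irrefl (sym e) p<n)))) (+-identityʳ (F p))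
... | inj₂ refl = trans (cong₂ _+_ (trans (Σ<-cong n below) (zeros n)) (cong (_* F n) (δ-refl n))) (+-identityʳ (F n))
  where
  below : ∀ i → i < n → δ i n * F i ≡ 0
  below i i<n = cong (_* F i) (≢⇒δ≡0 i n (λ e → <-irrefl e i<n))
  zeros : ∀ k → Σ< k (λ _ → 0) ≡ 0
  zeros zero    = refl
  zeros (suc k) = cong (_+ 0) (zeros k)

Σ<-+ : ∀ n f g → Σ< n (λ i → f i + g i) ≡ Σ< n f + Σ< n g
Σ<-+ zero    f g = refl
Σ<-+ (suc n) f g = trans (cong (_+ (f n + g n)) (Σ<-+ n f g)) (interchange (Σ< n f) (Σ< n g) (f n) (g n))

Σ<-bit-2^ : ∀ n p (F : ℕ → ℕ) → p < n → Σ< n (λ i → bit (2 ^ p) i * F i) ≡ F p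
Σ<-bit-2^ n p F p<n = trans (Σ<-cong n (λ i _ → cong (_* F i) (bit-2^ p i))) (Σ<-δ n p F p<n)

Σ<-bit-2^+2^ : ∀ n p q (F : ℕ → ℕ) → ¬ p ≡ q → p < n → q < n →
               Σ< n (λ i → bit (2 ^ p + 2 ^ q) i * F i) ≡ F p + F q
Σ<-bit-2^+2^ n p q F p≢q p<n q<n =
  trans (Σ<-cong n (λ i _ → trans (cong (_* F i) (bit-2^+2^ p q p≢q i)) (*-distribʳ-+ (F i) (δ i p) (δ i q))))
        (trans (Σ<-+ n _ _) (cong₂ _+_ (Σ<-δ n p F p<n) (Σ<-δ n q F q<n)))

p<2^p+2^q : ∀ p q → p < 2 ^ p + 2 ^ q
p<2^p+2^q p q = <-≤-trans (n<2^n p) (m≤m+n (2 ^ p) (2 ^ q))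

q<2^p+2^q : ∀ p q → q < 2 ^ p + 2 ^ q
q<2^p+2^q p q = <-≤-trans (n<2^n q) (m≤n+m (2 ^ q) (2 ^ p))

card-singleton : ∀ a → card (2 ^ a) ≡ 1
card-singleton a = trans (Σ<-cong (2 ^ a) (λ i _ → sym (*-identityʳ _))) (Σ<-bit-2^ (2 ^ a) a (λ _ → 1) (n<2^n a))

card-pair : ∀ a b → ¬ a ≡ b → card (2 ^ a + 2 ^ b) ≡ 2
card-pair a b a≢b = trans (Σ<-cong (2 ^ a + 2 ^ b) (λ i _ → sym (*-identityʳ _)))
  (Σ<-bit-2^+2^ _ a b (λ _ → 1) a≢b (p<2^p+2^q a b) (q<2^p+2^q a b))

restrCode-singleton : ∀ β a → restrCode β (2 ^ a) ≡ 2 ^ ⟪ a , β a ⟫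
restrCode-singleton β a = Σ<-bit-2^ (2 ^ a) a (λ i → 2 ^ ⟪ i , β i ⟫) (n<2^n a)

restrCode-pair : ∀ β a b → ¬ a ≡ b → restrCode β (2 ^ a + 2 ^ b) ≡ 2 ^ ⟪ a , β a ⟫ + 2 ^ ⟪ b , β b ⟫
restrCode-pair β a b a≢b = Σ<-bit-2^+2^ _ a b (λ i → 2 ^ ⟪ i , β i ⟫) a≢b (p<2^p+2^q a b) (q<2^p+2^q a b)

-- reads off β a from the canonical index of a finite part of the graph of β that contains a
decode : ℕ → ℕ → ℕ
decode c a = search (λ v → bit c ⟪ a , v ⟫) c

decodeᶜ : ComputableFn 2
decodeᶜ = fromExp (rec v₀ zer (IFZ (app₂ bitᶜ v₂ (app₂ pairᶜ v₃ v₁)) (sc v₀) v₁))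
                  (λ { (c ∷ a ∷ []) → decode c a }) (λ { (c ∷ a ∷ []) → refl })

δ-⟪⟫ : ∀ a u v → δ ⟪ a , u ⟫ ⟪ a , v ⟫ ≡ δ u v
δ-⟪⟫ a u v with u ≟ v
... | yes refl = trans (δ-refl ⟪ a , u ⟫) (sym (δ-refl u))
... | no u≢v   = trans (≢⇒δ≡0 _ _ (u≢v ∘ ⟪⟫-injective₂ {a} {u} {a} {v})) (sym (≢⇒δ≡0 u v u≢v))

decode-δ : ∀ c a b → (∀ u → bit c ⟪ a , u ⟫ ≡ δ u b) → b ≤ c → decode c a ≡ b
decode-δ c a b bits b≤c = search-unique _ c (λ u u<b → trans (bits u) (≢⇒δ≡0 u b (λ e → <-irrefl e u<b)))
  (λ h → 0≢1+n (trans (sym h) (trans (bits b) (δ-refl b)))) b≤c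

decode-singleton : ∀ β a → decode (restrCode β (2 ^ a)) a ≡ β a
decode-singleton β a rewrite restrCode-singleton β a =
  decode-δ _ a (β a) (λ u → trans (bit-2^ _ ⟪ a , u ⟫) (δ-⟪⟫ a u (β a)))
           (≤-trans (y≤⟪x,y⟫ a (β a)) (<⇒≤ (n<2^n ⟪ a , β a ⟫)))

decode-pair : ∀ β a b → ¬ a ≡ b → decode (restrCode β (2 ^ a + 2 ^ b)) a ≡ β a
decode-pair β a b a≢b rewrite restrCode-pair β a b a≢b =
  decode-δ _ a (β a) bits (≤-trans (y≤⟪x,y⟫ a (β a)) (<⇒≤ (p<2^p+2^q ⟪ a , β a ⟫ ⟪ b , β b ⟫)))
  where
  bits : ∀ u → bit (2 ^ ⟪ a , β a ⟫ + 2 ^ ⟪ b , β b ⟫) ⟪ a , u ⟫ ≡ δ u (β a)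
  bits u = trans (bit-2^+2^ _ _ (a≢b ∘ ⟪⟫-injective₁) ⟪ a , u ⟫)
    (trans (cong₂ _+_ (δ-⟪⟫ a u (β a)) (≢⇒δ≡0 _ _ (a≢b ∘ ⟪⟫-injective₁))) (+-identityʳ _))

module _ {G : CGraph} where

  infixr 5 _++ʷ_

  _++ʷ_ : ∀ {x y z n m} → Walk G x y n → Walk G y z m → Walk G x z (n + m)
  here     ++ʷ q = q
  step e p ++ʷ q = step e (p ++ʷ q)

  castʷ : ∀ {x y n m} → n ≡ m → Walk G x y n → Walk G x y m
  castʷ refl p = p

  reverseʷ : ∀ {x y n} → Walk G x y n → Walk G y x n
  reverseʷ here = here
  reverseʷ {n = suc n} (step {x} {z} e p) =
    castʷ (+-comm n 1) (reverseʷ p ++ʷ step (trans (symm G z x) e) here)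

walk-≅ : ∀ {G H} ((φ , _ , φ∈ , _ , _ , _ , φ-edge) : G ≅ H) → ∀ {x y n} → Dom G x → Walk G x y n → Walk H (φ x) (φ y) n
walk-≅ iso x∈ here = here
walk-≅ {G} {H} iso@(φ , _ , φ∈ , _ , _ , _ , φ-edge) {x} x∈ (step {z = z} e p) =
  step (trans (sym (φ-edge x z x∈ z∈)) e) (walk-≅ iso z∈ p)
  where z∈ = proj₂ (edge-dom G x z e)

connected-≅ : ∀ {G H} → G ≅ H → Connected G → Connected H
connected-≅ {G} {H} iso@(φ , ψ , _ , ψ∈ , _ , φψ , _) G-connected y₁ y₂ y₁∈ y₂∈ =
  let n , w = G-connected (ψ y₁) (ψ y₂) (ψ∈ y₁ y₁∈) (ψ∈ y₂ y₂∈)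
  in n , subst₂ (λ a b → Walk H a b n) (φψ y₁ y₁∈) (φψ y₂ y₂∈) (walk-≅ iso (ψ∈ y₁ y₁∈) w)

dom-infinite : ∀ {G} → size G ≡ nothing → ∀ x → Dom G x
dom-infinite G-infinite x = subst (λ s → InDom s x) (sym G-infinite) tt

ℕ↛Fin : ∀ n (φ ψ : ℕ → ℕ) → (∀ x → φ x < n) → (∀ x → ψ (φ x) ≡ x) → ⊥
ℕ↛Fin n φ ψ φ<n ψφ with pigeonhole (n<1+n n) (λ i → fromℕ< (φ<n (toℕ i)))
... | i , j , i<j , eq = <-irrefl (trans (sym (ψφ _)) (trans (cong ψ φi≡φj) (ψφ _))) i<j
  where
  φi≡φj : φ (toℕ i) ≡ φ (toℕ j)
  φi≡φj = trans (sym (toℕ-fromℕ< _)) (trans (cong toℕ eq) (toℕ-fromℕ< _))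

infinite-≅ : ∀ {G H} → G ≅ H → size G ≡ nothing → size H ≡ nothing
infinite-≅ {G} {H} (φ , ψ , φ∈ , _ , ψφ , _ , _) G-infinite with size H
... | nothing = refl
... | just n  = ⊥-elim (ℕ↛Fin n φ ψ (λ x → φ∈ x (ω x)) (λ x → ψφ x (ω x)))
  where ω = dom-infinite {G} G-infinite

-- Gadget graphs

data Vertex : Set where
  hub   : Vertex
  apex  : ℕ → Vertex
  spoke : ℕ → ℕ → Vertex
  link  : ℕ → ℕ → ℕ → Vertex

ray : ℕ → ℕ → Vertex
ray a zero    = hub
ray a (suc i) = spoke a i

gadget : Vertex → ℕ
gadget hub          = 0
gadget (apex a)     = a
gadget (spoke a i)  = a
gadget (link a s m) = a

-- the code of a vertex other than the hub is  1 + ⟪ gadget , ⟪ t , q ⟫ ⟫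
tag arg : Vertex → ℕ
tag hub          = 0
tag (apex a)     = 0
tag (spoke a i)  = 0
tag (link a s m) = suc s
arg hub          = 0
arg (apex a)     = 0
arg (spoke a i)  = suc i
arg (link a s m) = m

code : Vertex → ℕ
code hub = 0
code X   = suc ⟪ gadget X , ⟪ tag X , arg X ⟫ ⟫

gadgetₙ tagₙ argₙ : ℕ → ℕ
gadgetₙ x = π₁ (pred x)
tagₙ    x = π₁ (π₂ (pred x))
argₙ    x = π₂ (π₂ (pred x))

gadgetₑ tagₑ argₑ : ∀ {n} → Exp n → Exp n
gadgetₑ x = app₁ π₁ᶜ (app₁ predᶜ x)
tagₑ    x = app₁ π₁ᶜ (app₁ π₂ᶜ (app₁ predᶜ x))
argₑ    x = app₁ π₂ᶜ (app₁ π₂ᶜ (app₁ predᶜ x))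

vertexFrom : ℕ → ℕ → ℕ → Vertex
vertexFrom a zero    zero    = apex a
vertexFrom a zero    (suc i) = spoke a i
vertexFrom a (suc s) m       = link a s m

vertex : ℕ → Vertex
vertex zero    = hub
vertex (suc x) = vertexFrom (gadgetₙ (suc x)) (tagₙ (suc x)) (argₙ (suc x))

code-vertexFrom : ∀ a t q → code (vertexFrom a t q) ≡ suc ⟪ a , ⟪ t , q ⟫ ⟫
code-vertexFrom a zero    zero    = refl
code-vertexFrom a zero    (suc q) = refl
code-vertexFrom a (suc t) q       = refl

code-vertex : ∀ x → code (vertex x) ≡ x
code-vertex zero    = refl
code-vertex (suc x) = trans (code-vertexFrom (π₁ x) (π₁ (π₂ x)) (π₂ (π₂ x)))
  (cong suc (trans (cong ⟪ π₁ x ,_⟫ (⟪π₁,π₂⟫ (π₂ x))) (⟪π₁,π₂⟫ x)))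

gadgetₙ-suc : ∀ a t q → gadgetₙ (suc ⟪ a , ⟪ t , q ⟫ ⟫) ≡ a
gadgetₙ-suc a t q = π₁-⟪⟫ a _

tagₙ-suc : ∀ a t q → tagₙ (suc ⟪ a , ⟪ t , q ⟫ ⟫) ≡ t
tagₙ-suc a t q = trans (cong π₁ (π₂-⟪⟫ a _)) (π₁-⟪⟫ t q)

argₙ-suc : ∀ a t q → argₙ (suc ⟪ a , ⟪ t , q ⟫ ⟫) ≡ q
argₙ-suc a t q = trans (cong π₂ (π₂-⟪⟫ a _)) (π₂-⟪⟫ t q)

gadgetₙ-code : ∀ X → gadgetₙ (code X) ≡ gadget X
gadgetₙ-code hub          = π₁-0
gadgetₙ-code (apex a)     = gadgetₙ-suc a 0 0
gadgetₙ-code (spoke a i)  = gadgetₙ-suc a 0 (suc i)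
gadgetₙ-code (link a s m) = gadgetₙ-suc a (suc s) m

tagₙ-code : ∀ X → tagₙ (code X) ≡ tag X
tagₙ-code hub          = trans (cong π₁ π₂-0) π₁-0
tagₙ-code (apex a)     = tagₙ-suc a 0 0
tagₙ-code (spoke a i)  = tagₙ-suc a 0 (suc i)
tagₙ-code (link a s m) = tagₙ-suc a (suc s) m

argₙ-code : ∀ X → argₙ (code X) ≡ arg X
argₙ-code hub          = trans (cong π₂ π₂-0) π₂-0
argₙ-code (apex a)     = argₙ-suc a 0 0
argₙ-code (spoke a i)  = argₙ-suc a 0 (suc i)
argₙ-code (link a s m) = argₙ-suc a (suc s) m

gadgetₙ-vertex : ∀ x → gadgetₙ x ≡ gadget (vertex x)
gadgetₙ-vertex x = trans (cong gadgetₙ (sym (code-vertex x))) (gadgetₙ-code (vertex x))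

vertex-code : ∀ X → vertex (code X) ≡ X
vertex-code hub = refl
vertex-code X@(apex a)     rewrite gadgetₙ-code X | tagₙ-code X | argₙ-code X = refl
vertex-code X@(spoke a i)  rewrite gadgetₙ-code X | tagₙ-code X | argₙ-code X = refl
vertex-code X@(link a s m) rewrite gadgetₙ-code X | tagₙ-code X | argₙ-code X = refl

module GadgetGraph (A : ℕ → ℕ → ℕ) (A-computable : Computable₂ A) where

  Aᶜ : ComputableFn 2
  Aᶜ = fromComputable₂ A-computable

  height : ℕ → ℕ → ℕ → ℕ
  height a s m = A a s + m

  data Arc : Vertex → Vertex → Set where
    ray-arc    : ∀ a i → Arc (ray a i) (ray a (suc i))
    apex-arc   : ∀ a s m → Arc (link a s m) (apex a)
    height-arc : ∀ a s m → Arc (link a s m) (ray a (height a s m))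

  -- the indicator of an arc from x to y, given both codes together with their tag, arg and gadget
  arcFormula : (x t q g y t′ q′ g′ : ℕ) → ℕ
  arcFormula x t q g y t′ q′ g′ =
    ifz x
      (ifz y 0 (ifz t′ (δ q′ 1) 0))
      (ifz t
        (ifz q 0 (ifz y 0 (ifz t′ (ifz q′ 0 (δ g g′ * δ q′ (suc q))) 0)))
        (ifz y (δ (A g (pred t) + q) 0)
           (ifz t′ (ifz q′ (δ g g′) (δ g g′ * δ (A g (pred t) + q) q′)) 0)))

  arcFormulaₑ : ∀ {n} (x t q g y t′ q′ g′ : Exp n) → Exp n
  arcFormulaₑ x t q g y t′ q′ g′ =
    IFZ x
      (IFZ y zer (IFZ t′ (q′ == lit 1) zer))
      (IFZ t
        (IFZ q zer (IFZ y zer (IFZ t′ (IFZ q′ zer ((g == g′) ⊗ (q′ == sc q))) zer)))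
        (IFZ y ((app₂ Aᶜ g (app₁ predᶜ t) ⊕ q) == zer)
           (IFZ t′ (IFZ q′ (g == g′) ((g == g′) ⊗ ((app₂ Aᶜ g (app₁ predᶜ t) ⊕ q) == q′))) zer)))

  arcₙ : ℕ → ℕ → ℕ
  arcₙ x y = arcFormula x (tagₙ x) (argₙ x) (gadgetₙ x) y (tagₙ y) (argₙ y) (gadgetₙ y)

  arcᵥ : Vertex → Vertex → ℕ
  arcᵥ X Y = arcFormula (code X) (tag X) (arg X) (gadget X) (code Y) (tag Y) (arg Y) (gadget Y)

  arcₙ-code : ∀ X Y → arcₙ (code X) (code Y) ≡ arcᵥ X Y
  arcₙ-code X Y rewrite tagₙ-code X | argₙ-code X | gadgetₙ-code X | tagₙ-code Y | argₙ-code Y | gadgetₙ-code Y = refl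

  δ*δ≢0 : ∀ a b c d → ¬ δ a b * δ c d ≡ 0 → a ≡ b × c ≡ d
  δ*δ≢0 a b c d ne with δ≡0⊎δ≡1 a b
  ... | inj₁ e = ⊥-elim (ne (cong (_* δ c d) e))
  ... | inj₂ e = δ≡1⇒≡ a b e , δ≢0⇒≡ c d (λ e′ → ne (trans (cong₂ _*_ e e′) refl))

  arcᵥ-sound : ∀ X Y → ¬ arcᵥ X Y ≡ 0 → Arc X Y
  arcᵥ-sound hub          hub                ne = ⊥-elim (ne refl)
  arcᵥ-sound hub          (apex b)           ne = ⊥-elim (ne refl)
  arcᵥ-sound hub          (spoke b zero)     ne = ray-arc b 0
  arcᵥ-sound hub          (spoke b (suc j))  ne = ⊥-elim (ne refl)
  arcᵥ-sound hub          (link b s m)       ne = ⊥-elim (ne refl)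
  arcᵥ-sound (apex a)     Y                  ne = ⊥-elim (ne refl)
  arcᵥ-sound (spoke a i)  hub                ne = ⊥-elim (ne refl)
  arcᵥ-sound (spoke a i)  (apex b)           ne = ⊥-elim (ne refl)
  arcᵥ-sound (spoke a i)  (spoke b j)        ne with δ*δ≢0 a b (suc j) (suc (suc i)) ne
  ... | refl , refl = ray-arc a (suc i)
  arcᵥ-sound (spoke a i)  (link b s m)       ne = ⊥-elim (ne refl)
  arcᵥ-sound (link a s m) hub                ne =
    subst (Arc (link a s m)) (cong (ray a) (δ≢0⇒≡ _ 0 ne)) (height-arc a s m)
  arcᵥ-sound (link a s m) (apex b)           ne with δ≢0⇒≡ a b ne
  ... | refl = apex-arc a s m
  arcᵥ-sound (link a s m) (spoke b j)        ne with δ*δ≢0 a b (height a s m) (suc j) ne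
  ... | refl , e = subst (Arc (link a s m)) (cong (ray a) e) (height-arc a s m)
  arcᵥ-sound (link a s m) (link b s′ m′)     ne = ⊥-elim (ne refl)

  arcᵥ-complete : ∀ {X Y} → Arc X Y → arcᵥ X Y ≡ 1
  arcᵥ-complete (ray-arc a zero)    = refl
  arcᵥ-complete (ray-arc a (suc i)) = cong₂ _*_ (δ-refl a) (δ-refl i)
  arcᵥ-complete (apex-arc a s m)    = δ-refl a
  arcᵥ-complete (height-arc a s m) with height a s m
  ... | zero  = refl
  ... | suc j = cong₂ _*_ (δ-refl a) (δ-refl j)

  arcᵥ-irreflexive : ∀ X → arcᵥ X X ≡ 0
  arcᵥ-irreflexive hub          = refl
  arcᵥ-irreflexive (apex a)     = refl
  arcᵥ-irreflexive (spoke a i)  = trans (cong (_* δ i (suc i)) (δ-refl a)) (trans (+-comm (δ i (suc i)) 0) (δ[i,1+i]≡0 i))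
    where
    δ[i,1+i]≡0 : ∀ i → δ i (suc i) ≡ 0
    δ[i,1+i]≡0 zero    = refl
    δ[i,1+i]≡0 (suc i) = δ[i,1+i]≡0 i
  arcᵥ-irreflexive (link a s m) = refl

  Adjacent : Vertex → Vertex → Set
  Adjacent X Y = Arc X Y ⊎ Arc Y X

  edgeₙ : ℕ → ℕ → Bool
  edgeₙ x y = 0 <ᵇ (arcₙ x y + arcₙ y x)

  edgeₙ-code : ∀ X Y → edgeₙ (code X) (code Y) ≡ (0 <ᵇ (arcᵥ X Y + arcᵥ Y X))
  edgeₙ-code X Y = cong (0 <ᵇ_) (cong₂ _+_ (arcₙ-code X Y) (arcₙ-code Y X))

  edge-complete : ∀ X Y → Adjacent X Y → edgeₙ (code X) (code Y) ≡ true
  edge-complete X Y (inj₁ a) = trans (edgeₙ-code X Y) (cong (λ t → 0 <ᵇ (t + arcᵥ Y X)) (arcᵥ-complete a))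
  edge-complete X Y (inj₂ a) = trans (edgeₙ-code X Y)
    (trans (cong (λ t → 0 <ᵇ (arcᵥ X Y + t)) (arcᵥ-complete a)) (cong (0 <ᵇ_) (+-comm (arcᵥ X Y) 1)))

  edge-sound : ∀ x y → edgeₙ x y ≡ true → Adjacent (vertex x) (vertex y)
  edge-sound x y e = adjacent (vertex x) (vertex y) (subst₂ (λ a b → edgeₙ a b ≡ true) (sym (code-vertex x)) (sym (code-vertex y)) e)
    where
    adjacent : ∀ X Y → edgeₙ (code X) (code Y) ≡ true → Adjacent X Y
    adjacent X Y e with arcᵥ X Y in eXY | arcᵥ Y X in eYX | trans (sym (edgeₙ-code X Y)) e
    ... | suc _ | _     | _ = inj₁ (arcᵥ-sound X Y (λ z → 1+n≢0 (trans (sym eXY) z)))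
    ... | zero  | suc _ | _ = inj₂ (arcᵥ-sound Y X (λ z → 1+n≢0 (trans (sym eYX) z)))
    ... | zero  | zero  | ()

  edge-computable : Computable₂ (λ x y → χ (edgeₙ x y))
  edge-computable = computable₂ _ (IFZ (arcₑ v₀ v₁ ⊕ arcₑ v₁ v₀) zer (lit 1)) (λ x y → χ-0<ᵇ (arcₙ x y + arcₙ y x))
    where
    arcₑ : ∀ {n} → Exp n → Exp n → Exp n
    arcₑ x y = arcFormulaₑ x (tagₑ x) (argₑ x) (gadgetₑ x) y (tagₑ y) (argₑ y) (gadgetₑ y)
    χ-0<ᵇ : ∀ n → ifz n 0 1 ≡ χ (0 <ᵇ n)
    χ-0<ᵇ zero    = refl
    χ-0<ᵇ (suc n) = refl

  edge-irreflexive : ∀ x → edgeₙ x x ≡ false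
  edge-irreflexive x = subst (λ z → edgeₙ z z ≡ false) (code-vertex x)
    (trans (edgeₙ-code (vertex x) (vertex x)) (cong (λ t → 0 <ᵇ (t + t)) (arcᵥ-irreflexive (vertex x))))

  G : CGraph
  G = record
    { size      = nothing
    ; edge      = edgeₙ
    ; edge-comp = edge-computable
    ; symm      = λ x y → cong (0 <ᵇ_) (+-comm (arcₙ x y) (arcₙ y x))
    ; irrefl    = edge-irreflexive
    ; edge-dom  = λ _ _ _ → tt , tt
    }

-- positions inside one gadget: the ray (onRay 0 is the hub), the apex and the links
data Local : Set where
  onRay  : ℕ → Local
  atApex : Local
  atLink : ℕ → ℕ → Local

-- k is the lowest height at which a link meets the ray; h s m is the height of link s m
localDist : ℕ → (ℕ → ℕ → ℕ) → Local → Local → ℕ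
localDist k h (onRay i)    (onRay j)      = ∣ i - j ∣ ⊓ (4 + (k ∸ i) + (k ∸ j))
localDist k h (onRay i)    atApex         = 2 + (k ∸ i)
localDist k h (onRay i)    (atLink s m)   = suc (∣ h s m - i ∣ ⊓ (2 + (k ∸ i)))
localDist k h atApex       (onRay j)      = 2 + (k ∸ j)
localDist k h atApex       atApex         = 0
localDist k h atApex       (atLink s m)   = 1
localDist k h (atLink s m) (onRay j)      = suc (∣ h s m - j ∣ ⊓ (2 + (k ∸ j)))
localDist k h (atLink s m) atApex         = 1
localDist k h (atLink s m) (atLink s′ m′) = ifz (δ s s′ * δ m m′) 2 0

data LocalArc (h : ℕ → ℕ → ℕ) : Local → Local → Set where
  ray-step    : ∀ i → LocalArc h (onRay i) (onRay (suc i))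
  apex-step   : ∀ s m → LocalArc h (atLink s m) atApex
  height-step : ∀ s m → LocalArc h (atLink s m) (onRay (h s m))

⊓-mono-+ : ∀ c {a a′ b b′} → a ≤ c + a′ → b ≤ c + b′ → a ⊓ b ≤ c + (a′ ⊓ b′)
⊓-mono-+ c {a} {a′} {b} {b′} p q = subst (a ⊓ b ≤_) (sym (+-distribˡ-⊓ c a′ b′)) (⊓-mono-≤ p q)

∣n-1+n∣≡1 : ∀ n → ∣ n - suc n ∣ ≡ 1
∣n-1+n∣≡1 zero    = refl
∣n-1+n∣≡1 (suc n) = ∣n-1+n∣≡1 n

∣i-j∣≤1+∣1+i-j∣ : ∀ i j → ∣ i - j ∣ ≤ 1 + ∣ suc i - j ∣
∣i-j∣≤1+∣1+i-j∣ i j = ≤-trans (∣-∣-triangle i (suc i) j) (≤-reflexive (cong (_+ ∣ suc i - j ∣) (∣n-1+n∣≡1 i)))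

∣1+i-j∣≤1+∣i-j∣ : ∀ i j → ∣ suc i - j ∣ ≤ 1 + ∣ i - j ∣
∣1+i-j∣≤1+∣i-j∣ i j = ≤-trans (∣-∣-triangle (suc i) i j)
  (≤-reflexive (cong (_+ ∣ i - j ∣) (trans (∣-∣-comm (suc i) i) (∣n-1+n∣≡1 i))))

k∸i≤1+k∸1+i : ∀ k i → k ∸ i ≤ 1 + (k ∸ suc i)
k∸i≤1+k∸1+i k i = subst (λ t → k ∸ i ≤ suc t) (pred[m∸n]≡m∸[1+n] k i) (≤-suc-pred (k ∸ i))
  where
  ≤-suc-pred : ∀ m → m ≤ suc (pred m)
  ≤-suc-pred zero    = z≤n
  ≤-suc-pred (suc m) = ≤-refl

k∸1+i≤1+k∸i : ∀ k i → k ∸ suc i ≤ 1 + (k ∸ i)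
k∸1+i≤1+k∸i k i = ≤-trans (∸-monoʳ-≤ k (n≤1+n i)) (n≤1+n (k ∸ i))

ifz-2-0≤2 : ∀ c → ifz c 2 0 ≤ 2
ifz-2-0≤2 zero    = ≤-refl
ifz-2-0≤2 (suc c) = z≤n

module _ (k : ℕ) (h : ℕ → ℕ → ℕ) (k≤h : ∀ s m → k ≤ h s m) where

  private
    D = localDist k h

  k∸h≡0 : ∀ s m → k ∸ h s m ≡ 0
  k∸h≡0 s m = m≤n⇒m∸n≡0 (k≤h s m)

  k∸j≤∣h-j∣ : ∀ s m j → k ∸ j ≤ ∣ h s m - j ∣
  k∸j≤∣h-j∣ s m j = ≤-trans (∸-monoˡ-≤ j (k≤h s m)) (m∸n≤∣m-n∣ (h s m) j)

  localDist-refl : ∀ P → D P P ≡ 0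
  localDist-refl (onRay i)    = cong (_⊓ (4 + (k ∸ i) + (k ∸ i))) (∣n-n∣≡0 i)
  localDist-refl atApex       = refl
  localDist-refl (atLink s m) rewrite δ-refl s | δ-refl m = refl

  localDist-arc-source : ∀ {P Q} → LocalArc h P Q → ∀ R → D P R ≤ suc (D Q R)
  localDist-arc-source (ray-step i) (onRay j) =
    ⊓-mono-+ 1 (∣i-j∣≤1+∣1+i-j∣ i j) (+-monoʳ-≤ 4 (+-monoˡ-≤ (k ∸ j) (k∸i≤1+k∸1+i k i)))
  localDist-arc-source (ray-step i) atApex = +-monoʳ-≤ 2 (k∸i≤1+k∸1+i k i)
  localDist-arc-source (ray-step i) (atLink s m) =
    s≤s (⊓-mono-+ 1 (subst₂ (λ a b → a ≤ 1 + b) (∣-∣-comm i (h s m)) (∣-∣-comm (suc i) (h s m)) (∣i-j∣≤1+∣1+i-j∣ i (h s m)))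
                    (+-monoʳ-≤ 2 (k∸i≤1+k∸1+i k i)))
  localDist-arc-source (apex-step s m)   (onRay j)      = s≤s (m⊓n≤n _ _)
  localDist-arc-source (apex-step s m)   atApex         = s≤s z≤n
  localDist-arc-source (apex-step s m)   (atLink s′ m′) = ≤-trans (ifz-2-0≤2 (δ s s′ * δ m m′)) (s≤s (s≤s z≤n))
  localDist-arc-source (height-step s m) (onRay j)      =
    s≤s (⊓-mono-≤ ≤-refl (+-monoʳ-≤ 2 (m≤n+m (k ∸ j) (2 + (k ∸ h s m)))))
  localDist-arc-source (height-step s m) atApex         = s≤s z≤n
  localDist-arc-source (height-step s m) (atLink s′ m′) = ≤-trans (ifz-2-0≤2 (δ s s′ * δ m m′)) (s≤s (s≤s z≤n))

  localDist-arc-target : ∀ {P Q} → LocalArc h P Q → ∀ R → D Q R ≤ suc (D P R)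
  localDist-arc-target (ray-step i) (onRay j) =
    ⊓-mono-+ 1 (∣1+i-j∣≤1+∣i-j∣ i j) (+-monoʳ-≤ 4 (+-monoˡ-≤ (k ∸ j) (k∸1+i≤1+k∸i k i)))
  localDist-arc-target (ray-step i) atApex = +-monoʳ-≤ 2 (k∸1+i≤1+k∸i k i)
  localDist-arc-target (ray-step i) (atLink s m) =
    s≤s (⊓-mono-+ 1 (subst₂ (λ a b → a ≤ 1 + b) (∣-∣-comm (suc i) (h s m)) (∣-∣-comm i (h s m)) (∣1+i-j∣≤1+∣i-j∣ i (h s m)))
                    (+-monoʳ-≤ 2 (k∸1+i≤1+k∸i k i)))
  localDist-arc-target (apex-step s m) (onRay j) =
    subst (2 + (k ∸ j) ≤_) (sym (+-distribˡ-⊓ 2 _ _)) (⊓-glb (+-monoʳ-≤ 2 (k∸j≤∣h-j∣ s m j)) (m≤n+m _ 2))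
  localDist-arc-target (apex-step s m) atApex         = z≤n
  localDist-arc-target (apex-step s m) (atLink s′ m′) = s≤s z≤n
  localDist-arc-target (height-step s m) (onRay j) =
    subst (∣ h s m - j ∣ ⊓ (4 + (k ∸ h s m) + (k ∸ j)) ≤_) (sym (+-distribˡ-⊓ 2 _ _))
      (⊓-mono-≤ (m≤n+m _ 2) (≤-reflexive (cong (λ t → 4 + t + (k ∸ j)) (k∸h≡0 s m))))
  localDist-arc-target (height-step s m) atApex = ≤-reflexive (cong (2 +_) (k∸h≡0 s m))
  localDist-arc-target (height-step s m) (atLink s′ m′) with δ≡0⊎δ≡1 s s′ | δ≡0⊎δ≡1 m m′
  ... | inj₂ e₁ | inj₂ e₂ rewrite e₁ | e₂ | δ≡1⇒≡ s s′ e₁ | δ≡1⇒≡ m m′ e₂ =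
    s≤s (≤-trans (m⊓n≤m _ _) (≤-reflexive (∣n-n∣≡0 (h s′ m′))))
  ... | inj₁ e₁ | _       rewrite e₁      = s≤s (≤-trans (m⊓n≤n _ _) (≤-reflexive (cong (2 +_) (k∸h≡0 s m))))
  ... | inj₂ e₁ | inj₁ e₂ rewrite e₁ | e₂ = s≤s (≤-trans (m⊓n≤n _ _) (≤-reflexive (cong (2 +_) (k∸h≡0 s m))))

module GadgetDistance (A : ℕ → ℕ → ℕ) (A-computable : Computable₂ A) where

  open GadgetGraph A A-computable

  position : Vertex → Local
  position hub          = onRay 0
  position (apex a)     = atApex
  position (spoke a i)  = onRay (suc i)
  position (link a s m) = atLink s m

  place : ℕ → Local → Vertex
  place a (onRay i)    = ray a i
  place a atApex       = apex a
  place a (atLink s m) = link a s m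

  data InGadget (a : ℕ) : Vertex → Set where
    hub∈   : InGadget a hub
    apex∈  : InGadget a (apex a)
    spoke∈ : ∀ i → InGadget a (spoke a i)
    link∈  : ∀ s m → InGadget a (link a s m)

  inGadget-self : ∀ X → InGadget (gadget X) X
  inGadget-self hub          = hub∈
  inGadget-self (apex a)     = apex∈
  inGadget-self (spoke a i)  = spoke∈ i
  inGadget-self (link a s m) = link∈ s m

  inGadget-ray : ∀ a i → InGadget a (ray a i)
  inGadget-ray a zero    = hub∈
  inGadget-ray a (suc i) = spoke∈ i

  position-ray : ∀ a i → position (ray a i) ≡ onRay i
  position-ray a zero    = refl
  position-ray a (suc i) = refl

  place-position : ∀ {a X} → InGadget a X → place a (position X) ≡ X
  place-position hub∈        = refl
  place-position apex∈       = refl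
  place-position (spoke∈ i)  = refl
  place-position (link∈ s m) = refl

  -- a shortest path between different gadgets passes through the hub;
  -- kX and kY stand for the limits K of the gadgets of X and Y
  distFormula : ℕ → ℕ → Vertex → Vertex → ℕ
  distFormula kX kY X Y =
    ifz (δ (gadget X) (gadget Y))
      (localDist kX (height (gadget X)) (position X) (onRay 0) + localDist kY (height (gadget Y)) (onRay 0) (position Y))
      (localDist kX (height (gadget X)) (position X) (position Y))

  module _ (K : ℕ → ℕ) (K-attained : ∀ a → Σ ℕ λ s → A a s ≡ K a) (K-min : ∀ a s → K a ≤ A a s) where

    D : ℕ → Local → Local → ℕ
    D a = localDist (K a) (height a)

    dist : Vertex → Vertex → ℕ
    dist X Y = distFormula (K (gadget X)) (K (gadget Y)) X Y

    K≤height : ∀ a s m → K a ≤ height a s m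
    K≤height a s m = ≤-trans (K-min a s) (m≤m+n (A a s) m)

    dist-same : ∀ X Y → gadget X ≡ gadget Y → dist X Y ≡ D (gadget X) (position X) (position Y)
    dist-same X Y e rewrite e | δ-refl (gadget Y) = refl

    dist-differ : ∀ X Y → ¬ gadget X ≡ gadget Y →
                  dist X Y ≡ D (gadget X) (position X) (onRay 0) + D (gadget Y) (onRay 0) (position Y)
    dist-differ X Y ne rewrite ≢⇒δ≡0 _ _ ne = refl

    dist-from-hub : ∀ Y → dist hub Y ≡ D (gadget Y) (onRay 0) (position Y)
    dist-from-hub Y with 0 ≟ gadget Y
    ... | yes e = trans (dist-same hub Y e) (cong (λ a → D a (onRay 0) (position Y)) e)
    ... | no ne = dist-differ hub Y ne

    dist-to-hub : ∀ X → dist X hub ≡ D (gadget X) (position X) (onRay 0)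
    dist-to-hub X with gadget X ≟ 0
    ... | yes e = dist-same X hub e
    ... | no ne = trans (dist-differ X hub ne) (+-identityʳ _)

    dist-inside : ∀ {a} X Y → InGadget a X → InGadget a Y → dist X Y ≡ D a (position X) (position Y)
    dist-inside X Y hub∈         hub∈          = refl
    dist-inside X Y hub∈         apex∈         = dist-from-hub Y
    dist-inside X Y hub∈         (spoke∈ j)    = dist-from-hub Y
    dist-inside X Y hub∈         (link∈ s m)   = dist-from-hub Y
    dist-inside X Y apex∈        hub∈          = dist-to-hub X
    dist-inside X Y (spoke∈ i)   hub∈          = dist-to-hub X
    dist-inside X Y (link∈ s m)  hub∈          = dist-to-hub X
    dist-inside X Y apex∈        apex∈         = dist-same X Y refl
    dist-inside X Y apex∈        (spoke∈ j)    = dist-same X Y refl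
    dist-inside X Y apex∈        (link∈ s m)   = dist-same X Y refl
    dist-inside X Y (spoke∈ i)   apex∈         = dist-same X Y refl
    dist-inside X Y (spoke∈ i)   (spoke∈ j)    = dist-same X Y refl
    dist-inside X Y (spoke∈ i)   (link∈ s m)   = dist-same X Y refl
    dist-inside X Y (link∈ s m)  apex∈         = dist-same X Y refl
    dist-inside X Y (link∈ s m)  (spoke∈ j)    = dist-same X Y refl
    dist-inside X Y (link∈ s m)  (link∈ s′ m′) = dist-same X Y refl

    dist-across : ∀ {a} X Y → InGadget a X → ¬ gadget Y ≡ a →
                  dist X Y ≡ D a (position X) (onRay 0) + D (gadget Y) (onRay 0) (position Y)
    dist-across X Y hub∈        ne = dist-from-hub Y
    dist-across X Y apex∈       ne = dist-differ X Y (ne ∘ sym)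
    dist-across X Y (spoke∈ i)  ne = dist-differ X Y (ne ∘ sym)
    dist-across X Y (link∈ s m) ne = dist-differ X Y (ne ∘ sym)

    record LocalEdge (X Z : Vertex) : Set where
      constructor localEdge
      field
        a   : ℕ
        X∈  : InGadget a X
        Z∈  : InGadget a Z
        arc : LocalArc (height a) (position X) (position Z)

    arc-localEdge : ∀ {X Z} → Arc X Z → LocalEdge X Z
    arc-localEdge (ray-arc a i) =
      localEdge a (inGadget-ray a i) (spoke∈ i) (subst (λ P → LocalArc _ P _) (sym (position-ray a i)) (ray-step i))
    arc-localEdge (apex-arc a s m) = localEdge a (link∈ s m) apex∈ (apex-step s m)
    arc-localEdge (height-arc a s m) =
      localEdge a (link∈ s m) (inGadget-ray a _) (subst (LocalArc _ _) (sym (position-ray a _)) (height-step s m))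

    dist-localEdge : ∀ {X Z} → LocalEdge X Z → ∀ Y → dist X Y ≤ suc (dist Z Y) × dist Z Y ≤ suc (dist X Y)
    dist-localEdge {X} {Z} (localEdge a X∈ Z∈ arc) Y with gadget Y ≟ a
    ... | yes refl rewrite dist-inside X Y X∈ (inGadget-self Y) | dist-inside Z Y Z∈ (inGadget-self Y) =
      localDist-arc-source (K a) (height a) (K≤height a) arc (position Y) ,
      localDist-arc-target (K a) (height a) (K≤height a) arc (position Y)
    ... | no ne rewrite dist-across X Y X∈ ne | dist-across Z Y Z∈ ne =
      +-monoˡ-≤ _ (localDist-arc-source (K a) (height a) (K≤height a) arc (onRay 0)) ,
      +-monoˡ-≤ _ (localDist-arc-target (K a) (height a) (K≤height a) arc (onRay 0))

    dist-edge : ∀ {x z} → edgeₙ x z ≡ true → ∀ Y → dist (vertex x) Y ≤ suc (dist (vertex z) Y)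
    dist-edge {x} {z} e Y with edge-sound x z e
    ... | inj₁ xz = proj₁ (dist-localEdge (arc-localEdge xz) Y)
    ... | inj₂ zx = proj₂ (dist-localEdge (arc-localEdge zx) Y)

    dist-refl : ∀ X → dist X X ≡ 0
    dist-refl X = trans (dist-inside X X (inGadget-self X) (inGadget-self X))
                        (localDist-refl (K (gadget X)) (height (gadget X)) (K≤height (gadget X)) (position X))

    dist-≤-walk : ∀ {x y n} → Walk G x y n → dist (vertex x) (vertex y) ≤ n
    dist-≤-walk {x} here                  = ≤-reflexive (dist-refl (vertex x))
    dist-≤-walk {x} {y} (step {z = z} e p) = ≤-trans (dist-edge {x} {z} e (vertex y)) (s≤s (dist-≤-walk p))

    W : Vertex → Vertex → ℕ → Set
    W X Y = Walk G (code X) (code Y)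

    arc-walk : ∀ {X Y} → Arc X Y → W X Y 1
    arc-walk {X} {Y} a = step (edge-complete X Y (inj₁ a)) here

    arc-walk⁻ : ∀ {X Y} → Arc Y X → W X Y 1
    arc-walk⁻ {X} {Y} a = step (edge-complete X Y (inj₂ a)) here

    ray-up : ∀ a i d → W (ray a i) (ray a (i + d)) d
    ray-up a i zero    = subst (λ t → W (ray a i) (ray a t) 0) (sym (+-identityʳ i)) here
    ray-up a i (suc d) = subst (λ t → W (ray a i) (ray a t) (suc d)) (sym (+-suc i d))
                               (arc-walk (ray-arc a i) ++ʷ ray-up a (suc i) d)

    ray-walk : ∀ a i j → W (ray a i) (ray a j) ∣ i - j ∣
    ray-walk a i j with ≤-total i j
    ... | inj₁ i≤j = castʷ (sym (m≤n⇒∣m-n∣≡n∸m i≤j))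
                           (subst (λ t → W (ray a i) (ray a t) (j ∸ i)) (m+[n∸m]≡n i≤j) (ray-up a i (j ∸ i)))
    ... | inj₂ j≤i = castʷ (sym (m≤n⇒∣n-m∣≡n∸m j≤i))
                           (reverseʷ (subst (λ t → W (ray a j) (ray a t) (i ∸ j)) (m+[n∸m]≡n j≤i) (ray-up a j (i ∸ j))))

    -- through the link at height n of the stage at which K a is attained
    ray-apex : ∀ a n → K a ≤ n → W (ray a n) (apex a) 2
    ray-apex a n Ka≤n = arc-walk⁻ (subst (λ t → Arc ℓ (ray a t)) height≡n (height-arc a s₀ (n ∸ K a)))
                        ++ʷ arc-walk (apex-arc a s₀ (n ∸ K a))
      where
      s₀ = proj₁ (K-attained a)
      ℓ = link a s₀ (n ∸ K a)
      height≡n : height a s₀ (n ∸ K a) ≡ n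
      height≡n = trans (cong (_+ (n ∸ K a)) (proj₂ (K-attained a))) (m+[n∸m]≡n Ka≤n)

    ray-to-apex : ∀ a i → W (ray a i) (apex a) (2 + (K a ∸ i))
    ray-to-apex a i = castʷ (+-comm (K a ∸ i) 2) (ray-up a i (K a ∸ i) ++ʷ ray-apex a (i + (K a ∸ i)) (m≤n+m∸n (K a) i))

    localWalk : ∀ a P Q → W (place a P) (place a Q) (D a P Q)
    localWalk a (onRay i) (onRay j) with ≤-total ∣ i - j ∣ (4 + (K a ∸ i) + (K a ∸ j))
    ... | inj₁ le = castʷ (sym (m≤n⇒m⊓n≡m le)) (ray-walk a i j)
    ... | inj₂ ge = castʷ (trans (2+a+[2+b]≡4+a+b (K a ∸ i) (K a ∸ j)) (sym (m≥n⇒m⊓n≡n ge)))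
                          (ray-to-apex a i ++ʷ reverseʷ (ray-to-apex a j))
      where
      2+a+[2+b]≡4+a+b : ∀ a b → (2 + a) + (2 + b) ≡ 4 + a + b
      2+a+[2+b]≡4+a+b a b = cong suc (cong suc (trans (+-suc a (suc b)) (cong suc (+-suc a b))))
    localWalk a (onRay i) atApex = ray-to-apex a i
    localWalk a (onRay i) (atLink s m) with ≤-total ∣ height a s m - i ∣ (2 + (K a ∸ i))
    ... | inj₁ le = castʷ (trans (+-comm _ 1) (cong suc (trans (∣-∣-comm i (height a s m)) (sym (m≤n⇒m⊓n≡m le)))))
                          (ray-walk a i (height a s m) ++ʷ arc-walk⁻ (height-arc a s m))
    ... | inj₂ ge = castʷ (trans (+-comm _ 1) (cong suc (sym (m≥n⇒m⊓n≡n ge))))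
                          (ray-to-apex a i ++ʷ arc-walk⁻ (apex-arc a s m))
    localWalk a atApex       (onRay j)      = reverseʷ (ray-to-apex a j)
    localWalk a atApex       atApex         = here
    localWalk a atApex       (atLink s m)   = arc-walk⁻ (apex-arc a s m)
    localWalk a (atLink s m) (onRay j)      = reverseʷ (localWalk a (onRay j) (atLink s m))
    localWalk a (atLink s m) atApex         = arc-walk (apex-arc a s m)
    localWalk a (atLink s m) (atLink s′ m′) with s ≟ s′ | m ≟ m′
    ... | yes refl | yes refl rewrite δ-refl s | δ-refl m = here
    ... | no s≢s′  | _        rewrite ≢⇒δ≡0 s s′ s≢s′ = arc-walk (apex-arc a s m) ++ʷ arc-walk⁻ (apex-arc a s′ m′)
    ... | yes _    | no m≢m′  rewrite ≢⇒δ≡0 m m′ m≢m′ | *-zeroʳ (δ s s′) =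
      arc-walk (apex-arc a s m) ++ʷ arc-walk⁻ (apex-arc a s′ m′)

    walkInside : ∀ {a} X Y → InGadget a X → InGadget a Y → W X Y (D a (position X) (position Y))
    walkInside {a} X Y X∈ Y∈ =
      subst₂ (λ P Q → W P Q (D a (position X) (position Y))) (place-position X∈) (place-position Y∈)
             (localWalk a (position X) (position Y))

    walk : ∀ X Y → W X Y (dist X Y)
    walk X Y with gadget Y ≟ gadget X
    ... | yes e = castʷ (sym (dist-inside X Y (inGadget-self X) Y∈)) (walkInside X Y (inGadget-self X) Y∈)
      where Y∈ = subst (λ b → InGadget b Y) e (inGadget-self Y)
    ... | no ne = castʷ (sym (dist-across X Y (inGadget-self X) ne))
                        (walkInside X hub (inGadget-self X) hub∈ ++ʷ walkInside hub Y hub∈ (inGadget-self Y))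

    distₙ : ℕ → ℕ
    distₙ z = dist (vertex (π₁ z)) (vertex (π₂ z))

    walkₙ : ∀ x y → Walk G x y (dist (vertex x) (vertex y))
    walkₙ x y = subst₂ (λ p q → Walk G p q (dist (vertex x) (vertex y))) (code-vertex x) (code-vertex y) (walk (vertex x) (vertex y))

    distₙ-isDistFn : IsDistFn G distₙ
    distₙ-isDistFn x y =
      (λ _ → castʷ (sym distₙ-⟪⟫) (walkₙ x y) , λ m p → subst (_≤ m) (sym distₙ-⟪⟫) (dist-≤-walk p)) ,
      (λ out → ⊥-elim (out (tt , tt)))
      where
      distₙ-⟪⟫ : distₙ ⟪ x , y ⟫ ≡ dist (vertex x) (vertex y)
      distₙ-⟪⟫ = cong₂ (λ p q → dist (vertex p) (vertex q)) (π₁-⟪⟫ x y) (π₂-⟪⟫ x y)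

    connected : Connected G
    connected x y _ _ = _ , walkₙ x y

module DistanceComputable (A : ℕ → ℕ → ℕ) (A-computable : Computable₂ A) where

  open GadgetGraph A A-computable
  open GadgetDistance A A-computable

  -- a local position written as (kind, height on the ray, stage, offset) with kinds 0 = ray, 1 = apex, 2 = link
  data Represents : ℕ → ℕ → ℕ → ℕ → Local → Set where
    rep-ray  : ∀ i s m → Represents 0 i s m (onRay i)
    rep-apex : ∀ i s m → Represents 1 i s m atApex
    rep-link : ∀ i s m → Represents 2 i s m (atLink s m)

  localDistₑ : Exp 10
  localDistₑ =
    IFZ c₁
      (IFZ c₂ (app₂ minᶜ (app₂ absᶜ i₁ i₂) ((lit 4 ⊕ (k ⊖ i₁)) ⊕ (k ⊖ i₂)))
        (IFZ (app₁ predᶜ c₂) (lit 2 ⊕ (k ⊖ i₁)) (sc (app₂ minᶜ (app₂ absᶜ h₂ i₁) (lit 2 ⊕ (k ⊖ i₁))))))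
      (IFZ (app₁ predᶜ c₁)
        (IFZ c₂ (lit 2 ⊕ (k ⊖ i₂)) (IFZ (app₁ predᶜ c₂) zer (lit 1)))
        (IFZ c₂ (sc (app₂ minᶜ (app₂ absᶜ h₁ i₂) (lit 2 ⊕ (k ⊖ i₂))))
                (IFZ (app₁ predᶜ c₂) (lit 1) (IFZ ((s₁ == s₂) ⊗ (m₁ == m₂)) (lit 2) zer))))
    where
    k g c₁ i₁ s₁ m₁ c₂ i₂ s₂ m₂ h₁ h₂ : Exp 10
    k  = var (# 0)
    g  = var (# 1)
    c₁ = var (# 2)
    i₁ = var (# 3)
    s₁ = var (# 4)
    m₁ = var (# 5)
    c₂ = var (# 6)
    i₂ = var (# 7)
    s₂ = var (# 8)
    m₂ = var (# 9)
    h₁ = app₂ Aᶜ g s₁ ⊕ m₁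
    h₂ = app₂ Aᶜ g s₂ ⊕ m₂

  localDistᶜ : ComputableFn 10
  localDistᶜ = fromExp localDistₑ ⟦ localDistₑ ⟧ (λ _ → refl)

  localDistₙ : (k g c₁ i₁ s₁ m₁ c₂ i₂ s₂ m₂ : ℕ) → ℕ
  localDistₙ k g c₁ i₁ s₁ m₁ c₂ i₂ s₂ m₂ = ⟦ localDistₑ ⟧ (k ∷ g ∷ c₁ ∷ i₁ ∷ s₁ ∷ m₁ ∷ c₂ ∷ i₂ ∷ s₂ ∷ m₂ ∷ [])

  localDistₙ-correct : ∀ k g {c₁ i₁ s₁ m₁ c₂ i₂ s₂ m₂ P Q} → Represents c₁ i₁ s₁ m₁ P → Represents c₂ i₂ s₂ m₂ Q →
                       localDistₙ k g c₁ i₁ s₁ m₁ c₂ i₂ s₂ m₂ ≡ localDist k (height g) P Q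
  localDistₙ-correct k g (rep-ray _ _ _)  (rep-ray _ _ _)  = refl
  localDistₙ-correct k g (rep-ray _ _ _)  (rep-apex _ _ _) = refl
  localDistₙ-correct k g (rep-ray _ _ _)  (rep-link _ _ _) = refl
  localDistₙ-correct k g (rep-apex _ _ _) (rep-ray _ _ _)  = refl
  localDistₙ-correct k g (rep-apex _ _ _) (rep-apex _ _ _) = refl
  localDistₙ-correct k g (rep-apex _ _ _) (rep-link _ _ _) = refl
  localDistₙ-correct k g (rep-link _ _ _) (rep-ray _ _ _)  = refl
  localDistₙ-correct k g (rep-link _ _ _) (rep-apex _ _ _) = refl
  localDistₙ-correct k g (rep-link _ _ _) (rep-link _ _ _) = refl

  kindₙ heightₙ stageₙ : ℕ → ℕ
  kindₙ   x = ifz x 0 (ifz (tagₙ x) (ifz (argₙ x) 1 0) 2)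
  heightₙ x = ifz x 0 (argₙ x)
  stageₙ  x = pred (tagₙ x)

  kindₑ heightₑ stageₑ : ∀ {n} → Exp n → Exp n
  kindₑ   x = IFZ x zer (IFZ (tagₑ x) (IFZ (argₑ x) (lit 1) zer) (lit 2))
  heightₑ x = IFZ x zer (argₑ x)
  stageₑ  x = app₁ predᶜ (tagₑ x)

  represents : ∀ X → Represents (kindₙ (code X)) (heightₙ (code X)) (stageₙ (code X)) (argₙ (code X)) (position X)
  represents hub = rep-ray 0 _ _
  represents X@(apex a)     rewrite tagₙ-code X | argₙ-code X = rep-apex _ _ _
  represents X@(spoke a i)  rewrite tagₙ-code X | argₙ-code X = rep-ray (suc i) _ _
  represents X@(link a s m) rewrite tagₙ-code X | argₙ-code X = rep-link _ _ _

  distFormulaₙ : ℕ → ℕ → ℕ → ℕ → ℕ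
  distFormulaₙ kX kY x y =
    ifz (δ (gadgetₙ x) (gadgetₙ y))
      (localDistₙ kX (gadgetₙ x) (kindₙ x) (heightₙ x) (stageₙ x) (argₙ x) 0 0 0 0 +
       localDistₙ kY (gadgetₙ y) 0 0 0 0 (kindₙ y) (heightₙ y) (stageₙ y) (argₙ y))
      (localDistₙ kX (gadgetₙ x) (kindₙ x) (heightₙ x) (stageₙ x) (argₙ x) (kindₙ y) (heightₙ y) (stageₙ y) (argₙ y))

  distFormulaₑ : ∀ {n} → Exp n → Exp n → Exp n → Exp n → Exp n
  distFormulaₑ kX kY x y =
    IFZ (gadgetₑ x == gadgetₑ y)
      (app localDistᶜ (kX ∷ gadgetₑ x ∷ kindₑ x ∷ heightₑ x ∷ stageₑ x ∷ argₑ x ∷ zer ∷ zer ∷ zer ∷ zer ∷ []) ⊕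
       app localDistᶜ (kY ∷ gadgetₑ y ∷ zer ∷ zer ∷ zer ∷ zer ∷ kindₑ y ∷ heightₑ y ∷ stageₑ y ∷ argₑ y ∷ []))
      (app localDistᶜ (kX ∷ gadgetₑ x ∷ kindₑ x ∷ heightₑ x ∷ stageₑ x ∷ argₑ x ∷ kindₑ y ∷ heightₑ y ∷ stageₑ y ∷ argₑ y ∷ []))

  distFormulaₙ-code : ∀ kX kY X Y → distFormulaₙ kX kY (code X) (code Y) ≡ distFormula kX kY X Y
  distFormulaₙ-code kX kY X Y rewrite gadgetₙ-code X | gadgetₙ-code Y =
    cong₂ (ifz (δ (gadget X) (gadget Y)))
      (cong₂ _+_ (localDistₙ-correct kX (gadget X) (represents X) (rep-ray 0 0 0))
                 (localDistₙ-correct kY (gadget Y) (rep-ray 0 0 0) (represents Y)))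
      (localDistₙ-correct kX (gadget X) (represents X) (represents Y))

  distFormulaₙ-vertex : ∀ kX kY x y → distFormulaₙ kX kY x y ≡ distFormula kX kY (vertex x) (vertex y)
  distFormulaₙ-vertex kX kY x y =
    subst₂ (λ p q → distFormulaₙ kX kY p q ≡ distFormula kX kY (vertex x) (vertex y)) (code-vertex x) (code-vertex y)
           (distFormulaₙ-code kX kY (vertex x) (vertex y))

module Approximation {K : ℕ → ℕ} (approx : ApproxAbove K) where

  A : ℕ → ℕ → ℕ
  A = proj₁ approx

  A-computable : Computable₂ A
  A-computable = proj₁ (proj₂ approx)

  stage₀ : ℕ → ℕ
  stage₀ a = proj₁ (proj₂ (proj₂ (proj₂ approx)) a)

  A-stable : ∀ a s → stage₀ a ≤ s → A a s ≡ K a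
  A-stable a = proj₂ (proj₂ (proj₂ (proj₂ approx)) a)

  A-antitone : ∀ a {s s′} → s ≤ s′ → A a s′ ≤ A a s
  A-antitone a {s} {s′} s≤s′ with m≤n⇒m<n∨m≡n s≤s′
  ... | inj₂ refl = ≤-refl
  A-antitone a {s} {suc s′} _ | inj₁ s<1+s′ = ≤-trans (proj₁ (proj₂ (proj₂ approx)) a s′) (A-antitone a (≤-pred s<1+s′))

  K-attained : ∀ a → Σ ℕ λ s → A a s ≡ K a
  K-attained a = stage₀ a , A-stable a (stage₀ a) ≤-refl

  K-min : ∀ a s → K a ≤ A a s
  K-min a s with ≤-total s (stage₀ a)
  ... | inj₁ s≤s₀ = subst (_≤ A a s) (A-stable a (stage₀ a) ≤-refl) (A-antitone a s≤s₀)
  ... | inj₂ s₀≤s = ≤-reflexive (sym (A-stable a s s₀≤s))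

  firstStage : ℕ → ℕ → ℕ
  firstStage a n = search (λ s → leq (A a s) n) (stage₀ a)

  firstStage-least : ∀ a n s → A a s ≤ n → firstStage a n ≤ s
  firstStage-least a n s As≤n with firstStage a n ≤? s
  ... | yes le = le
  ... | no  gt = ⊥-elim (0≢1+n (trans (sym (search-minimal (λ s → leq (A a s) n) (stage₀ a) s (≰⇒> gt)))
                                      (≤⇒leq≡1 As≤n)))

  firstStage-reached : ∀ a n s → K a ≤ n → firstStage a n ≤ s → A a s ≤ n
  firstStage-reached a n s Ka≤n t≤s =
    ≤-trans (A-antitone a t≤s) (leq≢0⇒≤ _ _ (search-witness (λ s → leq (A a s) n) (stage₀ a) found))
    where
    found : ¬ leq (A a (stage₀ a)) n ≡ 0
    found e = 0≢1+n (trans (sym e) (≤⇒leq≡1 (subst (_≤ n) (sym (A-stable a (stage₀ a) ≤-refl)) Ka≤n)))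

gadgetGraph : ∀ {K} → ApproxAbove K → CGraph
gadgetGraph approx = GadgetGraph.G A A-computable
  where open Approximation approx

module Relabel {K K′ : ℕ → ℕ} (approx : ApproxAbove K) (approx′ : ApproxAbove K′)
               (β : ℕ → ℕ) (Kβ : ∀ a → K′ (β a) ≡ K a) where

  open Approximation approx
  module P′ = Approximation approx′
  module G  = GadgetGraph A A-computable
  module G′ = GadgetGraph P′.A P′.A-computable

  -- link a s m is sent to the link of β a at the same height whose stage lies equally far beyond the first
  -- stage that reaches this height
  stage′ : ℕ → ℕ → ℕ → ℕ
  stage′ a s m = P′.firstStage (β a) (G.height a s m) + (s ∸ firstStage a (G.height a s m))

  offset′ : ℕ → ℕ → ℕ → ℕ
  offset′ a s m = G.height a s m ∸ P′.A (β a) (stage′ a s m)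

  relabel : Vertex → Vertex
  relabel hub          = hub
  relabel (apex a)     = apex (β a)
  relabel (spoke a i)  = spoke (β a) i
  relabel (link a s m) = link (β a) (stage′ a s m) (offset′ a s m)

  K≤height : ∀ a s m → K a ≤ G.height a s m
  K≤height a s m = ≤-trans (K-min a s) (m≤m+n _ m)

  firstStage≤s : ∀ a s m → firstStage a (G.height a s m) ≤ s
  firstStage≤s a s m = firstStage-least a _ s (m≤m+n _ m)

  height-relabel : ∀ a s m → G′.height (β a) (stage′ a s m) (offset′ a s m) ≡ G.height a s m
  height-relabel a s m = m+[n∸m]≡n (P′.firstStage-reached (β a) _ (stage′ a s m)
    (subst (_≤ G.height a s m) (sym (Kβ a)) (K≤height a s m)) (m≤m+n _ _))

  relabel-ray : ∀ a n → relabel (ray a n) ≡ ray (β a) n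
  relabel-ray a zero    = refl
  relabel-ray a (suc n) = refl

  relabel-arc : ∀ {X Y} → G.Arc X Y → G′.Arc (relabel X) (relabel Y)
  relabel-arc (G.ray-arc a zero)    = G′.ray-arc (β a) 0
  relabel-arc (G.ray-arc a (suc i)) = G′.ray-arc (β a) (suc i)
  relabel-arc (G.apex-arc a s m)    = G′.apex-arc (β a) _ _
  relabel-arc (G.height-arc a s m)  =
    subst (G′.Arc (relabel (link a s m))) (trans (cong (ray (β a)) (height-relabel a s m)) (sym (relabel-ray a _)))
          (G′.height-arc (β a) _ _)

  relabel-adjacent : ∀ {X Y} → G.Adjacent X Y → G′.Adjacent (relabel X) (relabel Y)
  relabel-adjacent (inj₁ a) = inj₁ (relabel-arc a)
  relabel-adjacent (inj₂ a) = inj₂ (relabel-arc a)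

module RelabelInverse {K K′ : ℕ → ℕ} (approx : ApproxAbove K) (approx′ : ApproxAbove K′)
                      (β β′ : ℕ → ℕ) (Kβ : ∀ a → K′ (β a) ≡ K a) (Kβ′ : ∀ b → K (β′ b) ≡ K′ b)
                      (β′β : ∀ a → β′ (β a) ≡ a) where

  module R  = Relabel approx approx′ β Kβ
  module R′ = Relabel approx′ approx β′ Kβ′
  open Approximation approx
  module P′ = Approximation approx′

  relabel-inverse : ∀ X → R′.relabel (R.relabel X) ≡ X
  relabel-inverse hub          = refl
  relabel-inverse (apex a)     = cong apex (β′β a)
  relabel-inverse (spoke a i)  = cong (λ b → spoke b i) (β′β a)
  relabel-inverse (link a s m) =
    trans (cong (λ b → link b (R′.stage′ (β a) s′ m′) (R′.offset′ (β a) s′ m′)) (β′β a))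
          (cong₂ (link a) stage≡ offset≡)
    where
    n  = R.G.height a s m
    t  = firstStage a n
    t′ = P′.firstStage (β a) n
    s′ = R.stage′ a s m
    m′ = R.offset′ a s m
    height≡ : R.G′.height (β a) s′ m′ ≡ n
    height≡ = R.height-relabel a s m
    stage≡ : R′.stage′ (β a) s′ m′ ≡ s
    stage≡ = begin
      firstStage (β′ (β a)) (R.G′.height (β a) s′ m′) + (s′ ∸ P′.firstStage (β a) (R.G′.height (β a) s′ m′))
        ≡⟨ cong (λ h → firstStage (β′ (β a)) h + (s′ ∸ P′.firstStage (β a) h)) height≡ ⟩
      firstStage (β′ (β a)) n + (s′ ∸ t′)
        ≡⟨ cong (λ b → firstStage b n + (s′ ∸ t′)) (β′β a) ⟩
      t + ((t′ + (s ∸ t)) ∸ t′)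
        ≡⟨ cong (t +_) (m+n∸m≡n t′ (s ∸ t)) ⟩
      t + (s ∸ t)
        ≡⟨ m+[n∸m]≡n (R.firstStage≤s a s m) ⟩
      s ∎
      where open ≡-Reasoning
    offset≡ : R′.offset′ (β a) s′ m′ ≡ m
    offset≡ = begin
      R.G′.height (β a) s′ m′ ∸ A (β′ (β a)) (R′.stage′ (β a) s′ m′)
        ≡⟨ cong₂ (λ h b → h ∸ A b (R′.stage′ (β a) s′ m′)) height≡ (β′β a) ⟩
      n ∸ A a (R′.stage′ (β a) s′ m′)
        ≡⟨ cong (λ z → n ∸ A a z) stage≡ ⟩
      (A a s + m) ∸ A a s
        ≡⟨ m+n∸m≡n (A a s) m ⟩
      m ∎
      where open ≡-Reasoning

Bool-≡ : ∀ {a b : Bool} → (a ≡ true → b ≡ true) → (b ≡ true → a ≡ true) → a ≡ b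
Bool-≡ {true}  {true}  _ _ = refl
Bool-≡ {true}  {false} f _ = sym (f refl)
Bool-≡ {false} {true}  _ g = g refl
Bool-≡ {false} {false} _ _ = refl

gadgetGraph-≅ : ∀ {K K′} (approx : ApproxAbove K) (approx′ : ApproxAbove K′) (β β′ : ℕ → ℕ) →
                (∀ a → K′ (β a) ≡ K a) → (∀ a → β′ (β a) ≡ a) → (∀ b → β (β′ b) ≡ b) →
                gadgetGraph approx ≅ gadgetGraph approx′
gadgetGraph-≅ {K} {K′} approx approx′ β β′ Kβ β′β ββ′ =
  φ , ψ , (λ _ _ → tt) , (λ _ _ → tt) , (λ x _ → ψφ x) , (λ y _ → φψ y) , (λ x y _ _ → edge≡ x y)
  where
  Kβ′ : ∀ b → K (β′ b) ≡ K′ b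
  Kβ′ b = trans (sym (Kβ (β′ b))) (cong K′ (ββ′ b))
  module I  = RelabelInverse approx approx′ β β′ Kβ Kβ′ β′β
  module I′ = RelabelInverse approx′ approx β′ β Kβ′ Kβ ββ′
  module G  = I.R.G
  module G′ = I.R.G′

  φ ψ : ℕ → ℕ
  φ x = code (I.R.relabel (vertex x))
  ψ y = code (I.R′.relabel (vertex y))

  back-and-forth : ∀ x → code (I.R′.relabel (I.R.relabel (vertex x))) ≡ x
  back-and-forth x = trans (cong code (I.relabel-inverse (vertex x))) (code-vertex x)

  ψφ : ∀ x → ψ (φ x) ≡ x
  ψφ x = trans (cong (code ∘ I.R′.relabel) (vertex-code _)) (back-and-forth x)

  φψ : ∀ y → φ (ψ y) ≡ y
  φψ y = trans (cong (code ∘ I.R.relabel) (vertex-code _)) (trans (cong code (I′.relabel-inverse (vertex y))) (code-vertex y))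

  edge≡ : ∀ x y → G.edgeₙ x y ≡ G′.edgeₙ (φ x) (φ y)
  edge≡ x y = Bool-≡ forth back
    where
    forth : G.edgeₙ x y ≡ true → G′.edgeₙ (φ x) (φ y) ≡ true
    forth e = G′.edge-complete _ _ (I.R.relabel-adjacent (G.edge-sound x y e))
    back : G′.edgeₙ (φ x) (φ y) ≡ true → G.edgeₙ x y ≡ true
    back e = subst₂ (λ p q → G.edgeₙ p q ≡ true) (back-and-forth x) (back-and-forth y)
      (G.edge-complete (I.R′.relabel (I.R.relabel (vertex x))) (I.R′.relabel (I.R.relabel (vertex y)))
        (I.R′.relabel-adjacent (subst₂ G′.Adjacent (vertex-code (I.R.relabel (vertex x))) (vertex-code (I.R.relabel (vertex y)))
          (G′.edge-sound (φ x) (φ y) e))))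

-- Distances in computable connected graphs

module ComputableConnected (H : CGraph) (H-infinite : size H ≡ nothing) (H-connected : Connected H)
                           (h : ℕ → ℕ) (h-dist : IsDistFn H h) where

  inDom : ∀ x → Dom H x
  inDom = dom-infinite {H} H-infinite

  E : ℕ → ℕ → ℕ
  E x y = χ (edge H x y)

  Eᶜ : ComputableFn 2
  Eᶜ = fromComputable₂ (edge-comp H)

  -- c = ⟪ z₁ , ⟪ z₂ , … ⟫ ⟫ lists the vertices after x of a walk of length n from x to y
  isWalk : ℕ → ℕ → ℕ → ℕ → ℕ
  isWalk zero    x c y = δ x y
  isWalk (suc n) x c y = E x (π₁ c) * isWalk n (π₁ c) (π₂ c) y

  isWalk-sound : ∀ n x c y → ¬ isWalk n x c y ≡ 0 → Walk H x y n
  isWalk-sound zero    x c y ne with δ≢0⇒≡ x y ne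
  ... | refl = here
  isWalk-sound (suc n) x c y ne =
    step (edge≡true (λ e → ne (cong (_* _) e)))
         (isWalk-sound n (π₁ c) (π₂ c) y (λ e → ne (trans (cong (E x (π₁ c) *_) e) (*-zeroʳ (E x (π₁ c))))))
    where
    edge≡true : ¬ E x (π₁ c) ≡ 0 → edge H x (π₁ c) ≡ true
    edge≡true ne with edge H x (π₁ c)
    ... | true  = refl
    ... | false = ⊥-elim (ne refl)

  isWalk-complete : ∀ {x y n} → Walk H x y n → ∃ λ c → isWalk n x c y ≡ 1
  isWalk-complete {x} here = 0 , δ-refl x
  isWalk-complete {x} {y} {suc n} (step {z = z} e p) with isWalk-complete p
  ... | c , valid = ⟪ z , c ⟫ , subst₂ (λ u v → E x u * isWalk n u v y ≡ 1) (sym (π₁-⟪⟫ z c)) (sym (π₂-⟪⟫ z c))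
                                      (cong₂ _*_ (cong χ e) valid)

  -- isWalk is computed by iterating on states ⟪ current vertex , ⟪ rest of the list , product so far ⟫ ⟫
  walkStep : ℕ → ℕ
  walkStep st = ⟪ π₁ (π₁ (π₂ st)) , ⟪ π₂ (π₁ (π₂ st)) , π₂ (π₂ st) * E (π₁ st) (π₁ (π₁ (π₂ st))) ⟫ ⟫

  walkStep-⟪⟫ : ∀ x c p → walkStep ⟪ x , ⟪ c , p ⟫ ⟫ ≡ ⟪ π₁ c , ⟪ π₂ c , p * E x (π₁ c) ⟫ ⟫
  walkStep-⟪⟫ x c p rewrite π₂-⟪⟫ x ⟪ c , p ⟫ | π₁-⟪⟫ c p | π₂-⟪⟫ c p | π₁-⟪⟫ x ⟪ c , p ⟫ = refl

  walkCheck : ℕ → ℕ → ℕ → ℕ → ℕ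
  walkCheck n x c y = π₂ (π₂ st) * δ (π₁ st) y
    where st = primrec ⟪ x , ⟪ c , 1 ⟫ ⟫ (λ _ → walkStep) n

  walkCheck≡isWalk : ∀ n x c y → walkCheck n x c y ≡ isWalk n x c y
  walkCheck≡isWalk n x c y = trans (go n x c 1) (*-identityˡ _)
    where
    shift : ∀ st n → primrec (walkStep st) (λ _ → walkStep) n ≡ primrec st (λ _ → walkStep) (suc n)
    shift st zero    = refl
    shift st (suc n) = cong walkStep (shift st n)
    go : ∀ n x c p → (let st = primrec ⟪ x , ⟪ c , p ⟫ ⟫ (λ _ → walkStep) n in π₂ (π₂ st) * δ (π₁ st) y)
                     ≡ p * isWalk n x c y
    go zero    x c p = cong₂ (λ a b → a * δ b y) (trans (cong π₂ (π₂-⟪⟫ x _)) (π₂-⟪⟫ c p)) (π₁-⟪⟫ x _)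
    go (suc n) x c p =
      trans (cong (λ st → π₂ (π₂ st) * δ (π₁ st) y)
                  (trans (sym (shift _ n)) (cong (λ st → primrec st (λ _ → walkStep) n) (walkStep-⟪⟫ x c p))))
            (trans (go n (π₁ c) (π₂ c) (p * E x (π₁ c))) (*-assoc p _ _))

  walkCheckₑ : ∀ {n} → Exp n → Exp n → Exp n → Exp n → Exp n
  walkCheckₑ n x c y = app₁ π₂ᶜ (app₁ π₂ᶜ st) ⊗ (app₁ π₁ᶜ st == y)
    where
    st = rec n (app₂ pairᶜ x (app₂ pairᶜ c (lit 1)))
      (app₂ pairᶜ (app₁ π₁ᶜ (app₁ π₁ᶜ (app₁ π₂ᶜ v₁)))
        (app₂ pairᶜ (app₁ π₂ᶜ (app₁ π₁ᶜ (app₁ π₂ᶜ v₁)))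
          (app₁ π₂ᶜ (app₁ π₂ᶜ v₁) ⊗ app₂ Eᶜ (app₁ π₁ᶜ v₁) (app₁ π₁ᶜ (app₁ π₁ᶜ (app₁ π₂ᶜ v₁))))))

  -- w codes a walk from π₁ z to π₂ z of length π₁ w
  valid : ℕ → ℕ → ℕ
  valid z w = walkCheck (π₁ w) (π₁ z) (π₂ w) (π₂ z)

  validₑ : ∀ {n} → Exp n → Exp n → Exp n
  validₑ z w = walkCheckₑ (app₁ π₁ᶜ w) (app₁ π₁ᶜ z) (app₁ π₂ᶜ w) (app₁ π₂ᶜ z)

  valid-walk : ∀ z w → ¬ valid z w ≡ 0 → Walk H (π₁ z) (π₂ z) (π₁ w)
  valid-walk z w ne =
    isWalk-sound (π₁ w) (π₁ z) (π₂ w) (π₂ z) (ne ∘ trans (walkCheck≡isWalk (π₁ w) (π₁ z) (π₂ w) (π₂ z)))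

  walk-valid : ∀ {z n} → Walk H (π₁ z) (π₂ z) n → ∃ λ w → valid z w ≡ 1 × π₁ w ≡ n
  walk-valid {z} {n} p with isWalk-complete p
  ... | c , v = ⟪ n , c ⟫ , subst₂ (λ n′ c′ → walkCheck n′ (π₁ z) c′ (π₂ z) ≡ 1) (sym (π₁-⟪⟫ n c)) (sym (π₂-⟪⟫ n c))
                                    (trans (walkCheck≡isWalk n _ c _) v) , π₁-⟪⟫ n c

  some-valid : ∀ z → ∃ λ w → valid z w ≡ 1
  some-valid z with walk-valid {z} (proj₂ (H-connected (π₁ z) (π₂ z) (inDom _) (inDom _)))
  ... | w , w-valid , _ = w , w-valid

  firstWalk : ℕ → ℕ
  firstWalk z = search (valid z) (proj₁ (some-valid z))

  firstWalk-valid : ∀ z → ¬ valid z (firstWalk z) ≡ 0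
  firstWalk-valid z = search-witness (valid z) (proj₁ (some-valid z)) (λ e → 0≢1+n (trans (sym e) (proj₂ (some-valid z))))

  -- no bound on the first walk is computable, so it is found by unbounded minimisation
  firstWalkᶜ : ComputableFn 1
  firstWalkᶜ = computableFn (λ { (z ∷ []) → firstWalk z }) (Mf (compile invalidₑ)) (λ { (z ∷ []) → halts z })
    where
    invalidₑ : Exp 2
    invalidₑ = IFZ (validₑ v₁ v₀) (lit 1) zer
    ifz-≢0 : ∀ n → ¬ n ≡ 0 → ifz n 1 0 ≡ 0
    ifz-≢0 zero    ne = ⊥-elim (ne refl)
    ifz-≢0 (suc n) ne = refl
    halts : ∀ z → Mf (compile invalidₑ) [ z ∷ [] ]⇓ firstWalk z
    halts z = evM (subst (compile invalidₑ [ firstWalk z ∷ z ∷ [] ]⇓_) (ifz-≢0 _ (firstWalk-valid z))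
                        (compile-correct invalidₑ _))
                 (λ j j< → 0 , subst (compile invalidₑ [ j ∷ z ∷ [] ]⇓_)
                                     (cong (λ v → ifz v 1 0) (search-minimal (valid z) (proj₁ (some-valid z)) j j<))
                                     (compile-correct invalidₑ _))

  -- the length of the walk coded by w, or of the first walk if w codes none
  cost : ℕ → ℕ → ℕ
  cost z w = ifz (valid z w) (π₁ (firstWalk z)) (π₁ w)

  approx : ℕ → ℕ → ℕ
  approx z = primrec (cost z 0) (λ k r → r ⊓ cost z (suc k))

  approx-computable : Computable₂ approx
  approx-computable = computable₂ approx (rec v₁ (costₑ v₀ zer) (app₂ minᶜ v₁ (costₑ v₂ (sc v₀)))) (λ z s → refl)
    where
    costₑ : ∀ {n} → Exp n → Exp n → Exp n
    costₑ z w = IFZ (validₑ z w) (app₁ π₁ᶜ (app₁ firstWalkᶜ z)) (app₁ π₁ᶜ w)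

  approx-antitone : ∀ z s → approx z (suc s) ≤ approx z s
  approx-antitone z s = m⊓n≤m _ _

  h-isDist : ∀ z → IsDist H (π₁ z) (π₂ z) (h z)
  h-isDist z = subst (IsDist H (π₁ z) (π₂ z)) (cong h (⟪π₁,π₂⟫ z)) (proj₁ (h-dist (π₁ z) (π₂ z)) (inDom _ , inDom _))

  h≤cost : ∀ z w → h z ≤ cost z w
  h≤cost z w with valid z w in eq
  ... | zero  = proj₂ (h-isDist z) _ (valid-walk z (firstWalk z) (firstWalk-valid z))
  ... | suc _ = proj₂ (h-isDist z) _ (valid-walk z w (λ e → 0≢1+n (trans (sym e) eq)))

  h≤approx : ∀ z s → h z ≤ approx z s
  h≤approx z zero    = h≤cost z 0
  h≤approx z (suc s) = ⊓-glb (h≤approx z s) (h≤cost z (suc s))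

  approx≤cost : ∀ z w s → w ≤ s → approx z s ≤ cost z w
  approx≤cost z w s w≤s with m≤n⇒m<n∨m≡n w≤s
  approx≤cost z zero    zero    _ | inj₂ refl = ≤-refl
  approx≤cost z (suc w) (suc s) _ | inj₂ refl = m⊓n≤n _ _
  approx≤cost z w       (suc s) _ | inj₁ w<1+s = ≤-trans (m⊓n≤m _ _) (approx≤cost z w s (≤-pred w<1+s))

  distance-approxAbove : ApproxAbove h
  distance-approxAbove = approx , approx-computable , approx-antitone , stable
    where
    stable : ∀ z → ∃ λ s₀ → ∀ s → s₀ ≤ s → approx z s ≡ h z
    stable z with walk-valid {z} (proj₁ (h-isDist z))
    ... | w , w-valid , length =
      w , λ s w≤s → ≤-antisym (≤-trans (approx≤cost z w s w≤s) (≤-reflexive cost≡h)) (h≤approx z s)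
      where
      cost≡h : cost z w ≡ h z
      cost≡h rewrite w-valid = length

-- The graphs G_ω and G_f

Kω : ℕ → ℕ
Kω a = π₁ (π₂ a)

approxω : ApproxAbove Kω
approxω = (λ a _ → Kω a) , computable₂ _ (app₁ π₁ᶜ (app₁ π₂ᶜ v₀)) (λ _ _ → refl) ,
          (λ _ _ → ≤-refl) , λ _ → 0 , λ _ _ → refl

Gω : CGraph
Gω = gadgetGraph approxω

Gω-connected : Connected Gω
Gω-connected = GadgetDistance.connected A A-computable Kω K-attained K-min
  where open Approximation approxω

Gω-intrinsic : IntrinsicallyApproxAbove Gω
Gω-intrinsic H Gω≅H h h-dist =
  ComputableConnected.distance-approxAbove H (infinite-≅ {Gω} {H} Gω≅H refl) (connected-≅ {Gω} {H} Gω≅H Gω-connected)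
                                           h h-dist

-- gadget ⟪ x , j ⟫ of G_f has limit f x if j = 0 and limit k if j = 1 + ⟪ k , i ⟫
limit : ℕ → ℕ → ℕ
limit v j = ifz j v (π₁ (pred j))

limitₑ : ∀ {n} → Exp n → Exp n → Exp n
limitₑ v j = IFZ j v (app₁ π₁ᶜ (app₁ predᶜ j))

-- a bijection of ℕ that makes room for ⟪ v , 0 ⟫ at 0 and turns the first coordinate into the limit
module HilbertHotel (v : ℕ) where

  shift′ : ℕ → ℕ → ℕ
  shift′ k i with k ≟ v
  shift′ k zero    | yes _ = 0
  shift′ k (suc i) | yes _ = suc ⟪ v , i ⟫
  shift′ k i       | no _  = suc ⟪ k , i ⟫

  shift : ℕ → ℕ
  shift c = shift′ (π₁ c) (π₂ c)

  unshift′ : ℕ → ℕ → ℕ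
  unshift′ k i with k ≟ v
  ... | yes _ = ⟪ v , suc i ⟫
  ... | no _  = ⟪ k , i ⟫

  unshift : ℕ → ℕ
  unshift zero    = ⟪ v , 0 ⟫
  unshift (suc j) = unshift′ (π₁ j) (π₂ j)

  unshift′-v : ∀ i → unshift′ v i ≡ ⟪ v , suc i ⟫
  unshift′-v i with v ≟ v
  ... | yes _  = refl
  ... | no v≢v = ⊥-elim (v≢v refl)

  unshift′-≢ : ∀ {k} i → ¬ k ≡ v → unshift′ k i ≡ ⟪ k , i ⟫
  unshift′-≢ {k} i k≢v with k ≟ v
  ... | yes k≡v = ⊥-elim (k≢v k≡v)
  ... | no _    = refl

  shift′-v : ∀ i → shift′ v i ≡ ifz i 0 (suc ⟪ v , pred i ⟫)
  shift′-v i with v ≟ v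
  shift′-v zero    | yes _  = refl
  shift′-v (suc i) | yes _  = refl
  shift′-v i       | no v≢v = ⊥-elim (v≢v refl)

  shift′-≢ : ∀ {k} i → ¬ k ≡ v → shift′ k i ≡ suc ⟪ k , i ⟫
  shift′-≢ {k} i k≢v with k ≟ v
  ... | yes k≡v = ⊥-elim (k≢v k≡v)
  ... | no _    = refl

  limit-shift′ : ∀ k i → limit v (shift′ k i) ≡ k
  limit-shift′ k i with k ≟ v
  limit-shift′ k zero    | yes refl = refl
  limit-shift′ k (suc i) | yes refl = π₁-⟪⟫ v i
  limit-shift′ k i       | no _     = π₁-⟪⟫ k i

  unshift-shift′ : ∀ k i → unshift (shift′ k i) ≡ ⟪ k , i ⟫
  unshift-shift′ k i with k ≟ v
  unshift-shift′ k zero    | yes refl = refl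
  unshift-shift′ k (suc i) | yes refl rewrite π₁-⟪⟫ v i | π₂-⟪⟫ v i = unshift′-v i
  unshift-shift′ k i       | no k≢v   rewrite π₁-⟪⟫ k i | π₂-⟪⟫ k i = unshift′-≢ i k≢v

  shift-unshift′ : ∀ k i → shift (unshift′ k i) ≡ suc ⟪ k , i ⟫
  shift-unshift′ k i with k ≟ v
  ... | yes refl rewrite π₁-⟪⟫ v (suc i) | π₂-⟪⟫ v (suc i) = shift′-v (suc i)
  ... | no k≢v   rewrite π₁-⟪⟫ k i | π₂-⟪⟫ k i = shift′-≢ i k≢v

  limit-shift : ∀ c → limit v (shift c) ≡ π₁ c
  limit-shift c = limit-shift′ (π₁ c) (π₂ c)

  unshift-shift : ∀ c → unshift (shift c) ≡ c
  unshift-shift c = trans (unshift-shift′ (π₁ c) (π₂ c)) (⟪π₁,π₂⟫ c)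

  shift-unshift : ∀ j → shift (unshift j) ≡ j
  shift-unshift zero    rewrite π₁-⟪⟫ v 0 | π₂-⟪⟫ v 0 = shift′-v 0
  shift-unshift (suc j) = trans (shift-unshift′ (π₁ j) (π₂ j)) (cong suc (⟪π₁,π₂⟫ j))

module _ (f : ℕ → ℕ) (approx-f : ApproxAbove f) where

  open Approximation approx-f using (stage₀) renaming (A to g; A-computable to g-computable; A-stable to g-stable; A-antitone to g-antitone)

  Kf : ℕ → ℕ
  Kf a = limit (f (π₁ a)) (π₂ a)

  Af : ℕ → ℕ → ℕ
  Af a s = limit (g (π₁ a) s) (π₂ a)

  approxf : ApproxAbove Kf
  approxf = Af , computable₂ Af (limitₑ (app₂ (fromComputable₂ g-computable) (app₁ π₁ᶜ v₀) v₁) (app₁ π₂ᶜ v₀))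
                               (λ _ _ → refl)
          , (λ a s → antitone (π₂ a) s) , λ a → stage₀ (π₁ a) , stable (π₂ a)
    where
    antitone : ∀ {x} j s → limit (g x (suc s)) j ≤ limit (g x s) j
    antitone {x} zero    s = g-antitone x (n≤1+n s)
    antitone     (suc j) s = ≤-refl
    stable : ∀ {x} j s → stage₀ x ≤ s → limit (g x s) j ≡ limit (f x) j
    stable {x} zero    s s₀≤s = g-stable x s s₀≤s
    stable     (suc j) s _    = refl

  Gf : CGraph
  Gf = gadgetGraph approxf

  β β′ : ℕ → ℕ
  β  a = ⟪ π₁ a , HilbertHotel.shift   (f (π₁ a)) (π₂ a) ⟫
  β′ b = ⟪ π₁ b , HilbertHotel.unshift (f (π₁ b)) (π₂ b) ⟫

  Gω≅Gf : Gω ≅ Gf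
  Gω≅Gf = gadgetGraph-≅ approxω approxf β β′ Kfβ β′β ββ′
    where
    open HilbertHotel
    Kfβ : ∀ a → Kf (β a) ≡ Kω a
    Kfβ a = trans (cong₂ (λ x j → limit (f x) j) (π₁-⟪⟫ (π₁ a) _) (π₂-⟪⟫ (π₁ a) _)) (limit-shift (f (π₁ a)) (π₂ a))
    β′β : ∀ a → β′ (β a) ≡ a
    β′β a = trans (cong₂ (λ x j → ⟪ x , unshift (f x) j ⟫) (π₁-⟪⟫ (π₁ a) (shift (f (π₁ a)) (π₂ a))) (π₂-⟪⟫ (π₁ a) _))
                  (trans (cong ⟪ π₁ a ,_⟫ (unshift-shift (f (π₁ a)) (π₂ a))) (⟪π₁,π₂⟫ a))
    ββ′ : ∀ b → β (β′ b) ≡ b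
    ββ′ b = trans (cong₂ (λ x j → ⟪ x , shift (f x) j ⟫) (π₁-⟪⟫ (π₁ b) (unshift (f (π₁ b)) (π₂ b))) (π₂-⟪⟫ (π₁ b) _))
                  (trans (cong ⟪ π₁ b ,_⟫ (shift-unshift (f (π₁ b)) (π₂ b))) (⟪π₁,π₂⟫ b))

  open Approximation approxf using (K-attained; K-min) renaming (A-computable to Af-computable)
  open GadgetDistance Af Af-computable using (dist; distₙ; distₙ-isDistFn; dist-from-hub; distFormula)
  open DistanceComputable Af Af-computable using (distFormulaₙ; distFormulaₑ; distFormulaₙ-vertex)

  df : ℕ → ℕ
  df = distₙ Kf K-attained K-min

  df-isDistFn : IsDistFn Gf df
  df-isDistFn = distₙ-isDistFn Kf K-attained K-min

  probe : ℕ → ℕ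
  probe x = ⟪ code hub , code (apex ⟪ x , 0 ⟫) ⟫

  df-probe : ∀ x → df (probe x) ≡ 2 + f x
  df-probe x rewrite π₁-⟪⟫ 0 (code (apex ⟪ x , 0 ⟫)) | π₂-⟪⟫ 0 (code (apex ⟪ x , 0 ⟫)) | vertex-code (apex ⟪ x , 0 ⟫)
                   | dist-from-hub Kf K-attained K-min (apex ⟪ x , 0 ⟫) | π₁-⟪⟫ x 0 | π₂-⟪⟫ x 0 = refl

  f≤₁df : f ≤[ 1 ]btt df
  f≤₁df = (λ x → 2 ^ probe x) , (λ x c → decode c (probe x) ∸ 2) , p-computable , q-computable
        , λ x → ≤-reflexive (card-singleton (probe x)) , sym (reduction x)
    where
    probeₑ : ∀ {n} → Exp n → Exp n
    probeₑ x = app₂ pairᶜ zer (sc (app₂ pairᶜ (app₂ pairᶜ x zer) (app₂ pairᶜ zer zer)))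
    p-computable : Computable₁ (λ x → 2 ^ probe x)
    p-computable = computable₁ _ (app₁ powᶜ (probeₑ v₀)) (λ _ → refl)
    q-computable : Computable₂ (λ x c → decode c (probe x) ∸ 2)
    q-computable = computable₂ _ (app₂ decodeᶜ v₁ (probeₑ v₀) ⊖ lit 2) (λ _ _ → refl)
    reduction : ∀ x → decode (restrCode df (2 ^ probe x)) (probe x) ∸ 2 ≡ f x
    reduction x = trans (cong (_∸ 2) (trans (decode-singleton df (probe x)) (df-probe x))) (m+n∸m≡n 2 (f x))

  df-formula : ∀ z → df z ≡ distFormulaₙ (Kf (gadgetₙ (π₁ z))) (Kf (gadgetₙ (π₂ z))) (π₁ z) (π₂ z)
  df-formula z = sym (trans (distFormulaₙ-vertex _ _ (π₁ z) (π₂ z))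
                            (cong₂ (λ a b → distFormula (Kf a) (Kf b) (vertex (π₁ z)) (vertex (π₂ z)))
                                   (gadgetₙ-vertex (π₁ z)) (gadgetₙ-vertex (π₂ z))))

  -- the two gadget indices of f whose values df z needs; the second is moved off the first if they coincide
  query₁ query₂ : ℕ → ℕ
  query₁ z = π₁ (gadgetₙ (π₁ z))
  query₂ z = ifz (δ (query₁ z) (π₁ (gadgetₙ (π₂ z)))) (π₁ (gadgetₙ (π₂ z))) (suc (query₁ z))

  query₁≢query₂ : ∀ z → ¬ query₁ z ≡ query₂ z
  query₁≢query₂ z with δ≡0⊎δ≡1 (query₁ z) (π₁ (gadgetₙ (π₂ z)))
  ... | inj₁ e rewrite e = λ q → 0≢1+n (trans (sym e) (trans (cong (λ t → δ (query₁ z) t) (sym q)) (δ-refl (query₁ z))))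
  ... | inj₂ e rewrite e = λ q → 1+n≢n (sym q)

  queries : ℕ → ℕ
  queries z = 2 ^ query₁ z + 2 ^ query₂ z

  limitFrom : ℕ → ℕ → ℕ
  limitFrom c a = limit (decode c (π₁ a)) (π₂ a)

  decode-query₁ : ∀ z → decode (restrCode f (queries z)) (π₁ (gadgetₙ (π₁ z))) ≡ f (π₁ (gadgetₙ (π₁ z)))
  decode-query₁ z = decode-pair f (query₁ z) (query₂ z) (query₁≢query₂ z)

  decode-query₂ : ∀ z → decode (restrCode f (queries z)) (π₁ (gadgetₙ (π₂ z))) ≡ f (π₁ (gadgetₙ (π₂ z)))
  decode-query₂ z with δ≡0⊎δ≡1 (query₁ z) (π₁ (gadgetₙ (π₂ z)))
  ... | inj₂ e = subst (λ t → decode (restrCode f (queries z)) t ≡ f t) (δ≡1⇒≡ _ _ e) (decode-query₁ z)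
  ... | inj₁ e = trans (cong (λ c → decode (restrCode f c) u′) (+-comm (2 ^ query₁ z) (2 ^ query₂ z)))
                       (subst (λ t → decode (restrCode f (2 ^ t + 2 ^ query₁ z)) u′ ≡ f u′) (sym query₂≡u′)
                              (decode-pair f u′ (query₁ z) (λ q → query₁≢query₂ z (trans (sym q) (sym query₂≡u′)))))
    where
    u′ = π₁ (gadgetₙ (π₂ z))
    query₂≡u′ : query₂ z ≡ u′
    query₂≡u′ = cong (λ t → ifz t u′ (suc (query₁ z))) e

  df≤₂f : df ≤[ 2 ]btt f
  df≤₂f = queries , answer , p-computable , q-computable
        , λ z → ≤-reflexive (card-pair (query₁ z) (query₂ z) (query₁≢query₂ z)) , reduction z
    where
    answer : ℕ → ℕ → ℕ
    answer z c = distFormulaₙ (limitFrom c (gadgetₙ (π₁ z))) (limitFrom c (gadgetₙ (π₂ z))) (π₁ z) (π₂ z)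
    query₁ₑ query₂ₑ : ∀ {n} → Exp n → Exp n
    query₁ₑ z = app₁ π₁ᶜ (gadgetₑ (app₁ π₁ᶜ z))
    query₂ₑ z = IFZ (query₁ₑ z == app₁ π₁ᶜ (gadgetₑ (app₁ π₂ᶜ z))) (app₁ π₁ᶜ (gadgetₑ (app₁ π₂ᶜ z))) (sc (query₁ₑ z))
    limitFromₑ : ∀ {n} → Exp n → Exp n → Exp n
    limitFromₑ c a = limitₑ (app₂ decodeᶜ c (app₁ π₁ᶜ a)) (app₁ π₂ᶜ a)
    p-computable : Computable₁ queries
    p-computable = computable₁ _ (app₁ powᶜ (query₁ₑ v₀) ⊕ app₁ powᶜ (query₂ₑ v₀)) (λ _ → refl)
    q-computable : Computable₂ answer
    q-computable = computable₂ _ (distFormulaₑ (limitFromₑ v₁ (gadgetₑ (app₁ π₁ᶜ v₀))) (limitFromₑ v₁ (gadgetₑ (app₁ π₂ᶜ v₀)))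
                                               (app₁ π₁ᶜ v₀) (app₁ π₂ᶜ v₀)) (λ _ _ → refl)
    reduction : ∀ z → df z ≡ answer z (restrCode f (queries z))
    reduction z = trans (df-formula z) (sym (cong₂ (λ u v → distFormulaₙ (limit u (π₂ a)) (limit v (π₂ b)) (π₁ z) (π₂ z))
                                                   (decode-query₁ z) (decode-query₂ z)))
      where
      a = gadgetₙ (π₁ z)
      b = gadgetₙ (π₂ z)

corollary4p7 : Σ CGraph λ Gω → Connected Gω × IntrinsicallyApproxAbove Gω ×
  (∀ (f : ℕ → ℕ) → ApproxAbove f →
    Σ CGraph λ Gf → Gω ≅ Gf × Σ (ℕ → ℕ) λ df →
      IsDistFn Gf df × df ≤[ 2 ]btt f × f ≤[ 1 ]btt df)
corollary4p7 = Gω , Gω-connected , Gω-intrinsic ,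
  λ f approx-f → Gf f approx-f , Gω≅Gf f approx-f , df f approx-f , df-isDistFn f approx-f , df≤₂f f approx-f , f≤₁df f approx-f
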